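{- A finite signed graph $\Sigma=(\Gamma,\sigma)$ without loops is line consistent if and only if it is balanced and has the following form: (1) Each connected component of the negative subgraph $\Sigma^-$ is a circle, a nontrivial path, or a single vertex. (2) A circle component of $\Sigma^-$ is a block of $\Sigma$, and each of its vertices is incident with at most one other edge, which must be a positive isthmus. (3) A nontrivial path component $P$ of $\Sigma^-$ either is an induced subgraph of $\Sigma$, or is all but one edge of a circle that is a block of $\Sigma$ whose remaining edge is positive. The endpoints of $P$ have degree at most $2$ in $\Sigma$. Each internal vertex of $P$ is incident with at most one other edge, which must be a positive isthmus. Furthermore, $P$ either (a) is part of a nontrivial block of $\Sigma$ (and then its endpoints necessarily have degree $2$); or (b) consists entirely of isthmi and its endpoints are not incident with any nontrivial block of $\Sigma$ (and then the second edge, if any, incident with an endpoint is necessarily a positive isthmus).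
   Context: A signed graph $\Sigma=(\Gamma,\sigma)$ is a graph $\Gamma$ (multiple edges allowed, no loops) with an edge signature $\sigma:E(\Gamma)\to\{+,-\}$. A circle is a cycle (in a multigraph two parallel edges form a circle of length 2). The sign of a circle is the product of its edge signs; $\Sigma$ is balanced if every circle is positive. The degree $d(v)$ is the number of edges incident with $v$. The negative subgraph $\Sigma^-$ is the spanning subgraph whose edges are the negative edges. A path is nontrivial if it has positive length. An isthmus is an edge belonging to no circle. A block is a connected graph with no cutpoint; a block of $\Sigma$ is a maximal block subgraph of $\Sigma$; a block is nontrivial if it contains a circle (the trivial blocks are isthmi and isolated vertices). The line graph $L(\Gamma)$ has the edges of $\Gamma$ as vertices, two such vertices being joined by one edge for each common endpoint (so parallel edges of $\Gamma$ give a double edge in $L(\Gamma)$). The line graph of $\Sigma$ is the vertex-signed graph $(L(\Gamma),\sigma)$, each vertex $e$ of $L(\Gamma)$ getting sign $\sigma(e)$. A vertex-signed graph is consistent if every circle has positive product of its vertex signs. $\Sigma$ is line consistent if $(L(\Gamma),\sigma)$ is consistent. -}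

module Defs where

open import Data.Nat using (ℕ; zero; suc; _+_; _≤_; _<ᵇ_)
open import Data.Bool using (Bool; true; false; _∧_; _∨_; T)
open import Data.Fin using (Fin; zero; suc; toℕ; fromℕ; inject₁; fromℕ<)
open import Data.Fin.Properties using (_≟_)
open import Data.Product using (Σ; Σ-syntax; _×_; _,_; proj₁; proj₂)
open import Data.Sum using (_⊎_)
open import Relation.Nullary using (¬_; yes; no)
open import Relation.Nullary.Decidable using (⌊_⌋)
open import Relation.Binary.PropositionalEquality using (_≡_; _≢_)
open import Level using (Level)

data Sign : Set where
  ⊕ ⊖ : Sign

_·_ : Sign → Sign → Sign
⊕ · s = s
⊖ · ⊕ = ⊖
⊖ · ⊖ = ⊕

prod : ∀ {k} → (Fin k → Sign) → Sign
prod {zero}  f = ⊕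
prod {suc k} f = f zero · prod (λ i → f (suc i))

sumF : ∀ {k} → (Fin k → ℕ) → ℕ
sumF {zero}  f = 0
sumF {suc k} f = f zero + sumF (λ i → f (suc i))

-- Generic multigraphs: vertex type V, edge type E, each edge has an
-- (arbitrarily ordered) pair of endpoints.

Joins : {V E : Set} → (E → V × V) → E → V → V → Set
Joins ends e a b = ends e ≡ (a , b) ⊎ ends e ≡ (b , a)

cyc : ∀ {k} → Fin (suc k) → Fin (suc k)
cyc {k} i with suc (toℕ i) Data.Nat.<? suc k
... | yes p = fromℕ< p
... | no _  = zero

-- A circle of length suc k: distinct vertices v_0..v_k and distinct edges
-- e_0..e_k with e_i joining v_i and v_{i+1 mod (k+1)}.
-- (Length 1 would be a loop; length 2 = two parallel edges.)
record Circle {V E : Set} (ends : E → V × V) : Set where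
  field
    k     : ℕ
    vtx   : Fin (suc k) → V
    edg   : Fin (suc k) → E
    vinj  : ∀ i j → vtx i ≡ vtx j → i ≡ j
    einj  : ∀ i j → edg i ≡ edg j → i ≡ j
    joins : ∀ i → Joins ends (edg i) (vtx i) (vtx (cyc i))
open Circle public

record SGraph : Set where
  field
    n    : ℕ
    m    : ℕ
    ends : Fin m → Fin n × Fin n
    σ    : Fin m → Sign
open SGraph public

module _ (S : SGraph) where

  private
    Vx = Fin (n S)
    Ed = Fin (m S)
    en = ends S

  Loopless : Set
  Loopless = ∀ e → proj₁ (en e) ≢ proj₂ (en e)

  CircleΣ : Set
  CircleΣ = Circle en

  sgnC : CircleΣ → Sign
  sgnC C = prod (λ i → σ S (edg C i))

  Balanced : Set
  Balanced = ∀ (C : CircleΣ) → sgnC C ≡ ⊕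

  incB : Vx → Ed → Bool
  incB v e = ⌊ proj₁ (en e) ≟ v ⌋ ∨ ⌊ proj₂ (en e) ≟ v ⌋

  -- an edge of L(Γ): an unordered pair {e,f} of distinct edges (e < f)
  -- together with a common endpoint v (one L-edge per common endpoint)
  LEdge : Set
  LEdge = Σ[ t ∈ Ed × Ed × Vx ]
            T ((toℕ (proj₁ t) <ᵇ toℕ (proj₁ (proj₂ t)))
               ∧ incB (proj₂ (proj₂ t)) (proj₁ t)
               ∧ incB (proj₂ (proj₂ t)) (proj₁ (proj₂ t)))

  lends : LEdge → Ed × Ed
  lends ((e , f , v) , _) = (e , f)

  CircleL : Set
  CircleL = Circle lends

  LineConsistent : Set
  LineConsistent = ∀ (C : CircleL) → prod (λ i → σ S (vtx C i)) ≡ ⊕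

  Incident : Vx → Ed → Set
  Incident v e = proj₁ (en e) ≡ v ⊎ proj₂ (en e) ≡ v

  endCount : Vx → Ed → ℕ
  endCount v e = (if ⌊ proj₁ (en e) ≟ v ⌋ then 1 else 0)
               + (if ⌊ proj₂ (en e) ≟ v ⌋ then 1 else 0)
    where open import Data.Bool using (if_then_else_)

  deg : Vx → ℕ
  deg v = sumF (λ e → endCount v e)

  InCE : CircleΣ → Ed → Set
  InCE C e = Σ[ i ∈ Fin (suc (k C)) ] edg C i ≡ e

  InCV : CircleΣ → Vx → Set
  InCV C v = Σ[ i ∈ Fin (suc (k C)) ] vtx C i ≡ v

  Isthmus : Ed → Set
  Isthmus e = ∀ (C : CircleΣ) → ¬ InCE C e

  record Subgraph : Set₁ where
    field
      sv : Vx → Set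
      se : Ed → Set
  open Subgraph public

  IsSub : Subgraph → Set
  IsSub H = ∀ e → se H e → sv H (proj₁ (en e)) × sv H (proj₂ (en e))

  _⊆ₛ_ : Subgraph → Subgraph → Set
  H ⊆ₛ H' = (∀ v → sv H v → sv H' v) × (∀ e → se H e → se H' e)

  data Reach (es : Ed → Set) (u : Vx) : Vx → Set where
    here : Reach es u u
    step : ∀ {w x} e → Reach es u w → es e → Joins en e w x → Reach es u x

  Connected : Subgraph → Set
  Connected H = ∀ u w → sv H u → sv H w → Reach (se H) u w

  delV : Subgraph → Vx → Subgraph
  delV H v = record { sv = λ u → sv H u × u ≢ v
                    ; se = λ e → se H e × ¬ Incident v e }

  Cutpoint : Subgraph → Vx → Set
  Cutpoint H v = sv H v × ¬ Connected (delV H v)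

  IsBlockGraph : Subgraph → Set
  IsBlockGraph H = IsSub H × Connected H × (∀ v → ¬ Cutpoint H v)

  BlockOf : Subgraph → Set₁
  BlockOf H = IsBlockGraph H × (∀ H' → IsBlockGraph H' → H ⊆ₛ H' → H' ⊆ₛ H)

  NontrivialBlock : Subgraph → Set₁
  NontrivialBlock H = BlockOf H × Σ[ C ∈ CircleΣ ] (∀ i → se H (edg C i))

  circSub : CircleΣ → Subgraph
  circSub C = record { sv = InCV C ; se = InCE C }

  record Path : Set where
    field
      pk    : ℕ
      pvtx  : Fin (suc (suc pk)) → Vx
      pedg  : Fin (suc pk) → Ed
      pvinj : ∀ i j → pvtx i ≡ pvtx j → i ≡ j
      peinj : ∀ i j → pedg i ≡ pedg j → i ≡ j
      pjoins : ∀ i → Joins en (pedg i) (pvtx (inject₁ i)) (pvtx (suc i))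
  open Path public

  InPE : Path → Ed → Set
  InPE P e = Σ[ i ∈ Fin (suc (pk P)) ] pedg P i ≡ e

  InPV : Path → Vx → Set
  InPV P v = Σ[ i ∈ Fin (suc (suc (pk P))) ] pvtx P i ≡ v

  startP endP : Path → Vx
  startP P = pvtx P zero
  endP P = pvtx P (fromℕ (suc (pk P)))

  pathSub : Path → Subgraph
  pathSub P = record { sv = InPV P ; se = InPE P }

  InducedP : Path → Set
  InducedP P = ∀ e → InPV P (proj₁ (en e)) → InPV P (proj₂ (en e)) → InPE P e

  Negative : Ed → Set
  Negative e = σ S e ≡ ⊖

  -- the circle C is a connected component of Σ⁻
  NegCircleComp : CircleΣ → Set
  NegCircleComp C = (∀ i → Negative (edg C i))
                  × (∀ v e → InCV C v → Negative e → Incident v e → InCE C e)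

  -- the nontrivial path P is a connected component of Σ⁻
  NegPathComp : Path → Set
  NegPathComp P = (∀ i → Negative (pedg P i))
                × (∀ v e → InPV P v → Negative e → Incident v e → InPE P e)

  AtMostOneOther : Vx → (Ed → Set) → Set
  AtMostOneOther v X =
      (∀ e f → Incident v e → Incident v f → ¬ X e → ¬ X f → e ≡ f)
    × (∀ e → Incident v e → ¬ X e → (σ S e ≡ ⊕) × Isthmus e)

  Cond1 : Set
  Cond1 = ∀ v → (∀ e → Negative e → ¬ Incident v e)
              ⊎ (Σ[ C ∈ CircleΣ ] NegCircleComp C × InCV C v)
              ⊎ (Σ[ P ∈ Path ] NegPathComp P × InPV P v)

  Cond2 : Set₁
  Cond2 = ∀ (C : CircleΣ) → NegCircleComp C →
            BlockOf (circSub C)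
          × (∀ i → AtMostOneOther (vtx C i) (InCE C))

  Cond3 : Set₁
  Cond3 = ∀ (P : Path) → NegPathComp P →
      ( InducedP P
      ⊎ (Σ[ C ∈ CircleΣ ] BlockOf (circSub C)
           × Σ[ e ∈ Ed ] (σ S e ≡ ⊕) × InCE C e
             × (∀ f → InPE P f → InCE C f)
             × (∀ f → InCE C f → InPE P f ⊎ f ≡ e)))
    × deg (startP P) ≤ 2
    × deg (endP P) ≤ 2
    × (∀ i → i ≢ zero → i ≢ fromℕ (suc (pk P)) →
         AtMostOneOther (pvtx P i) (InPE P))
    × ( (Σ[ B ∈ Subgraph ] NontrivialBlock B × pathSub P ⊆ₛ B)
      ⊎ ((∀ i → Isthmus (pedg P i))
         × (∀ B → NontrivialBlock B → ¬ sv B (startP P) × ¬ sv B (endP P))))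

-- Three edges at a common vertex span a triangle of L(Γ); the edges of a circle of Γ, taken in
-- order, form a circle of L(Γ), and still do after inserting a further edge at one of its vertices.
-- Hence a line-consistent Σ is balanced, no vertex carries three negative edges, a vertex with a
-- single negative edge has degree at most 2, and an edge beside two negative edges at a vertex
-- cannot lie on a circle; conditions (1)–(3) follow from these facts.
-- Conversely, a circle of L(Γ) projects to a closed walk of Γ, positive by balance, except where
-- two consecutive L-edges meet at the same vertex of Γ.  There three edges of Γ meet with a
-- negative middle one; (1)–(3) force the outer two to be a negative edge and a positive isthmus,
-- which the L-circle cannot cross, so it is a triangle at that vertex, of positive sign.

module Submission where

open import Defs
open import Data.Product
open import Data.Sum
open import Data.Empty
open import Relation.Nullary
open import Relation.Binary.PropositionalEquality
open import Data.Nat as ℕ using (ℕ; zero; suc; _+_; _∸_; _≤_; _<_; z≤n; s≤s)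
import Data.Nat.Properties as NP
open import Data.Nat.DivMod using (_%_; m≤n⇒m%n≡m; n%n≡0; %-distribˡ-+; m%n%n≡m%n; [m+n]%n≡m%n; m<n⇒m%n≡m; m≤n⇒[n∸m]%m≡n%m)
open import Data.Fin using (Fin; zero; suc; toℕ; fromℕ; inject₁; fromℕ<)
open import Data.Fin.Relation.Unary.Top using (view; ‵fromℕ; ‵inject₁)
open import Data.Fin.Properties using (toℕ-injective; toℕ-fromℕ<; toℕ-inject₁; toℕ<n; toℕ-fromℕ; toℕ≤pred[n]; fromℕ≢inject₁; any?; all?; suc-injective; inject₁-injective; ¬∀⟶∃¬; injective⇒≤) renaming (_≟_ to _≟F_)
open import Data.List.Relation.Unary.All as All using (All; []; _∷_)
import Data.List.Relation.Unary.All.Properties as AllP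
open import Data.List.Relation.Unary.Any using (here; there)
open import Data.List.Membership.Propositional using (_∈_; _∉_)
open import Data.List.Membership.Propositional.Properties using (∈-++⁺ˡ; ∈-++⁺ʳ)
open import Data.List using (List; []; _∷_; _++_)
open import Relation.Nullary.Decidable using (_×-dec_; _→-dec_; ¬?; decidable-stable; ⌊_⌋; toWitness; fromWitness; map′; ¬¬-excluded-middle; T?)
open import Relation.Unary using (Decidable)
open import Function.Bundles using (Equivalence; _⇔_; mk⇔)
open import Data.Unit using (tt)
open import Data.Bool using (Bool; true; false; T)
open import Data.Bool.Properties using (T-∧; T-∨; T-irrelevant)

·-comm : ∀ a b → a · b ≡ b · a
·-comm ⊕ ⊕ = refl
·-comm ⊕ ⊖ = refl
·-comm ⊖ ⊕ = refl
·-comm ⊖ ⊖ = refl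

·-assoc : ∀ a b c → (a · b) · c ≡ a · (b · c)
·-assoc ⊕ b c = refl
·-assoc ⊖ ⊕ c = refl
·-assoc ⊖ ⊖ ⊕ = refl
·-assoc ⊖ ⊖ ⊖ = refl

·-⊕ʳ : ∀ a → a · ⊕ ≡ a
·-⊕ʳ ⊕ = refl
·-⊕ʳ ⊖ = refl

⊖≢⊕ : ⊖ ≢ ⊕
⊖≢⊕ ()

·-negative³ : ∀ {a b c x y z} → a ≡ x → b ≡ y → c ≡ z → x · (y · z) ≡ ⊖ → a · (b · c) ≢ ⊕
·-negative³ refl refl refl neg pos = ⊖≢⊕ (trans (sym neg) pos)

·-self : ∀ a → a · a ≡ ⊕
·-self ⊕ = refl
·-self ⊖ = refl

·-rotate3 : ∀ a b c → a · (b · c) ≡ b · (c · a)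
·-rotate3 ⊕ ⊕ ⊕ = refl
·-rotate3 ⊕ ⊕ ⊖ = refl
·-rotate3 ⊕ ⊖ ⊕ = refl
·-rotate3 ⊕ ⊖ ⊖ = refl
·-rotate3 ⊖ ⊕ ⊕ = refl
·-rotate3 ⊖ ⊕ ⊖ = refl
·-rotate3 ⊖ ⊖ ⊕ = refl
·-rotate3 ⊖ ⊖ ⊖ = refl

_≟ˢ_ : (a b : Sign) → Dec (a ≡ b)
⊕ ≟ˢ ⊕ = yes refl
⊕ ≟ˢ ⊖ = no λ ()
⊖ ≟ˢ ⊕ = no λ ()
⊖ ≟ˢ ⊖ = yes refl

≢⊖⇒≡⊕ : ∀ {a} → a ≢ ⊖ → a ≡ ⊕
≢⊖⇒≡⊕ {⊕} _ = refl
≢⊖⇒≡⊕ {⊖} h = ⊥-elim (h refl)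

prod-cong : ∀ {k} {f g : Fin k → Sign} → (∀ i → f i ≡ g i) → prod f ≡ prod g
prod-cong {zero} h = refl
prod-cong {suc k} h = cong₂ _·_ (h zero) (prod-cong (λ i → h (suc i)))

prod-mul : ∀ {k} (f g : Fin k → Sign) → prod (λ i → f i · g i) ≡ prod f · prod g
prod-mul {zero} f g = refl
prod-mul {suc k} f g = trans (cong ((f zero · g zero) ·_) (prod-mul (λ i → f (suc i)) (λ i → g (suc i))))
  (lem (f zero) (g zero) (prod (λ i → f (suc i))) (prod (λ i → g (suc i))))
  where
  lem : ∀ a b c d → (a · b) · (c · d) ≡ (a · c) · (b · d)
  lem a b c d = trans (·-assoc a b (c · d)) (trans (cong (a ·_) (trans (sym (·-assoc b c d))
     (trans (cong (_· d) (·-comm b c)) (·-assoc c b d)))) (sym (·-assoc a c (b · d))))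

prod-⊕ : ∀ {k} (f : Fin k → Sign) → (∀ i → f i ≡ ⊕) → prod f ≡ ⊕
prod-⊕ {zero} f h = refl
prod-⊕ {suc k} f h rewrite h zero = prod-⊕ (λ i → f (suc i)) (λ i → h (suc i))

prod-snoc : ∀ {k} (f : Fin (suc k) → Sign) → prod f ≡ prod (λ i → f (inject₁ i)) · f (fromℕ k)
prod-snoc {zero} f = ·-⊕ʳ (f zero)
prod-snoc {suc k} f = trans (cong (f zero ·_) (prod-snoc (λ i → f (suc i))))
  (sym (·-assoc (f zero) _ _))

cyc-inject₁ : ∀ {k} (i : Fin k) → cyc {k} (inject₁ i) ≡ suc i
cyc-inject₁ {k} i with suc (toℕ (inject₁ i)) ℕ.<? suc k
... | yes p = toℕ-injective (trans (toℕ-fromℕ< p) (cong suc (toℕ-inject₁ i)))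
... | no np = ⊥-elim (np (s≤s (subst (λ z → suc z ≤ k) (sym (toℕ-inject₁ i)) (toℕ<n i))))

cyc-last : ∀ k → cyc {k} (fromℕ k) ≡ zero
cyc-last k with suc (toℕ (fromℕ k)) ℕ.<? suc k
... | yes p = ⊥-elim (NP.<-irrefl refl (subst (λ z → suc z ≤ k) (toℕ-fromℕ k) (NP.≤-pred p)))
... | no np = refl

prod-cyc : ∀ {k} (f : Fin (suc k) → Sign) → prod (λ i → f (cyc i)) ≡ prod f
prod-cyc {k} f = trans (prod-snoc (λ i → f (cyc i)))
  (trans (cong₂ _·_ (prod-cong (λ i → cong f (cyc-inject₁ i))) (cong f (cyc-last k)))
  (·-comm _ (f zero)))

toℕ-cyc : ∀ {k} (i : Fin (suc k)) → toℕ (cyc i) ≡ suc (toℕ i) % suc k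
toℕ-cyc {k} i with suc (toℕ i) ℕ.<? suc k
... | yes p = trans (toℕ-fromℕ< p) (sym (m≤n⇒m%n≡m (NP.≤-pred p)))
... | no np = sym (trans (cong (λ z → suc z % suc k) eq) (n%n≡0 (suc k)))
  where
  eq : toℕ i ≡ k
  eq = NP.≤-antisym (toℕ≤pred[n] i) (NP.≮⇒≥ (λ q → np (s≤s q)))

cycN : ∀ {k} → ℕ → Fin (suc k) → Fin (suc k)
cycN zero i = i
cycN (suc t) i = cyc (cycN t i)

suc-mod : ∀ a n → .{{_ : ℕ.NonZero n}} → suc (a % n) % n ≡ suc a % n
suc-mod a n = trans (%-distribˡ-+ 1 (a % n) n)
  (trans (cong (λ z → (1 % n + z) % n) (m%n%n≡m%n a n)) (sym (%-distribˡ-+ 1 a n)))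

toℕ-cycN : ∀ {k} t (i : Fin (suc k)) → toℕ (cycN t i) ≡ (toℕ i + t) % suc k
toℕ-cycN {k} zero i = sym (trans (cong (_% suc k) (NP.+-identityʳ (toℕ i))) (m≤n⇒m%n≡m (toℕ≤pred[n] i)))
toℕ-cycN {k} (suc t) i = trans (toℕ-cyc (cycN t i)) (trans (cong (λ z → suc z % suc k) (toℕ-cycN t i))
  (trans (suc-mod (toℕ i + t) (suc k)) (cong (_% suc k) (sym (NP.+-suc (toℕ i) t)))))

cycN-full : ∀ {k} (i : Fin (suc k)) → cycN (suc k) i ≡ i
cycN-full {k} i = toℕ-injective (trans (toℕ-cycN (suc k) i)
  (trans ([m+n]%n≡m%n (toℕ i) (suc k)) (m≤n⇒m%n≡m (toℕ≤pred[n] i))))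

cycN-comm : ∀ {k} t (i : Fin (suc k)) → cycN t (cyc i) ≡ cyc (cycN t i)
cycN-comm zero i = refl
cycN-comm (suc t) i = cong cyc (cycN-comm t i)

mod-below-twice : ∀ y k → y < suc k + suc k → (y < suc k × y % suc k ≡ y) ⊎ (suc k ≤ y × y % suc k ≡ y ∸ suc k)
mod-below-twice y k lt with y ℕ.<? suc k
... | yes p = inj₁ (p , m<n⇒m%n≡m p)
... | no np = inj₂ (ge , trans (sym (m≤n⇒[n∸m]%m≡n%m ge)) (m<n⇒m%n≡m lt'))
  where
  ge = NP.≮⇒≥ np
  lt' : y ∸ suc k < suc k
  lt' = NP.+-cancelʳ-< (suc k) _ _ (subst (_< suc k + suc k) (sym (NP.m∸n+n≡m ge)) lt)

cycN-inj : ∀ {k} a b (i : Fin (suc k)) → a ≤ k → b ≤ k → cycN a i ≡ cycN b i → a ≡ b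
cycN-inj {k} a b i ak bk eq = go (mod-below-twice (x + a) k lta) (mod-below-twice (x + b) k ltb) eq'
  where
  x = toℕ i
  xk = toℕ≤pred[n] i
  eq' : (x + a) % suc k ≡ (x + b) % suc k
  eq' = trans (sym (toℕ-cycN a i)) (trans (cong toℕ eq) (toℕ-cycN b i))
  lta : x + a < suc k + suc k
  lta = NP.+-mono-≤-< (NP.m≤n⇒m≤1+n xk) (s≤s ak)
  ltb : x + b < suc k + suc k
  ltb = NP.+-mono-≤-< (NP.m≤n⇒m≤1+n xk) (s≤s bk)
  mix : ∀ a b → b ≤ k → suc k ≤ x + b → x + a ≡ x + b ∸ suc k → ⊥
  mix a b bk ge e = NP.<-irrefl refl (NP.≤-trans (s≤s bk) (NP.≤-trans (NP.m≤n+m (suc k) a)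
     (NP.≤-reflexive (NP.+-cancelˡ-≡ x _ _ (trans (sym (NP.+-assoc x a (suc k)))
       (trans (cong (_+ suc k) e) (NP.m∸n+n≡m ge)))))))
  go : _ → _ → (x + a) % suc k ≡ (x + b) % suc k → a ≡ b
  go (inj₁ (_ , p)) (inj₁ (_ , q)) e = NP.+-cancelˡ-≡ x _ _ (trans (sym p) (trans e q))
  go (inj₂ (ga , p)) (inj₂ (gb , q)) e = NP.+-cancelˡ-≡ x _ _
     (trans (sym (NP.m∸n+n≡m ga)) (trans (cong (_+ suc k) (trans (sym p) (trans e q))) (NP.m∸n+n≡m gb)))
  go (inj₁ (_ , p)) (inj₂ (gb , q)) e = ⊥-elim (mix a b bk gb (trans (sym p) (trans e q)))
  go (inj₂ (ga , p)) (inj₁ (_ , q)) e = ⊥-elim (mix b a ak ga (trans (sym q) (trans (sym e) p)))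

cycN-surj : ∀ {k} (i j : Fin (suc k)) → Σ ℕ λ t → t ≤ k × cycN t i ≡ j
cycN-surj {k} i j with toℕ i ℕ.≤? toℕ j
... | yes p = toℕ j ∸ toℕ i , NP.≤-trans (NP.m∸n≤m (toℕ j) (toℕ i)) (toℕ≤pred[n] j) ,
      toℕ-injective (trans (toℕ-cycN _ i) (trans (cong (_% suc k) (NP.m+[n∸m]≡n p)) (m≤n⇒m%n≡m (toℕ≤pred[n] j))))
... | no np = t , tk , toℕ-injective (trans (toℕ-cycN _ i) (trans (cong (_% suc k) e) (trans ([m+n]%n≡m%n (toℕ j) (suc k)) (m≤n⇒m%n≡m (toℕ≤pred[n] j)))))
  where
  lt : toℕ j < toℕ i
  lt = NP.≰⇒> np
  t = suc k + toℕ j ∸ toℕ i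
  e : toℕ i + t ≡ toℕ j + suc k
  e = trans (NP.m+[n∸m]≡n (NP.≤-trans (toℕ≤pred[n] i) (NP.≤-trans (NP.n≤1+n k) (NP.m≤m+n (suc k) (toℕ j)))))
        (NP.+-comm (suc k) (toℕ j))
  tk : t ≤ k
  tk = NP.≤-trans (NP.∸-monoʳ-≤ (suc k + toℕ j) lt)
        (NP.≤-reflexive (trans (cong (_∸ suc (toℕ j)) (sym (NP.+-suc k (toℕ j)))) (NP.m+n∸n≡m k (suc (toℕ j)))))

cycN≢id : ∀ {K} s (p : Fin (suc K)) → 1 ≤ s → s ≤ K → cycN s p ≢ p
cycN≢id s p a b eq with cycN-inj s 0 p b z≤n eq
cycN≢id (suc s) p a b eq | ()

cycN-≢ : ∀ {K} a b (p : Fin (suc K)) → a ≤ K → b ≤ K → a ≢ b → cycN a p ≢ cycN b p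
cycN-≢ a b p ak bk ne eq = ne (cycN-inj a b p ak bk eq)

cyc≢id : ∀ {k} → 1 ≤ k → (i : Fin (suc k)) → cyc i ≢ i
cyc≢id le i eq with cycN-inj 1 0 i le z≤n eq
... | ()

cyc²≢id : ∀ {k} → 2 ≤ k → (i : Fin (suc k)) → cyc (cyc i) ≢ i
cyc²≢id le i eq with cycN-inj 2 0 i le z≤n eq
... | ()

cyc²≡id : ∀ {K} → K ≡ 1 → (i : Fin (suc K)) → cyc (cyc i) ≡ i
cyc²≡id refl zero = refl
cyc²≡id refl (suc zero) = refl

prodN : (ℕ → Sign) → ℕ → Sign
prodN g zero = ⊕
prodN g (suc d) = prodN g d · g d

prodN-shift : ∀ g d → prodN g (suc d) ≡ g 0 · prodN (λ s → g (suc s)) d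
prodN-shift g zero = ·-comm ⊕ (g 0)
prodN-shift g (suc d) = trans (cong (_· g (suc d)) (prodN-shift g d)) (·-assoc (g 0) _ _)

prodN-cong : ∀ {g h} d → (∀ s → s < d → g s ≡ h s) → prodN g d ≡ prodN h d
prodN-cong zero e = refl
prodN-cong (suc d) e = cong₂ _·_ (prodN-cong d (λ s lt → e s (NP.m≤n⇒m≤1+n lt))) (e d NP.≤-refl)

ix : ∀ {k} → ℕ → Fin (suc k)
ix zero = zero
ix {zero} (suc s) = zero
ix {suc k} (suc s) = suc (ix s)

toℕ-ix : ∀ {k} s → s ≤ k → toℕ (ix {k} s) ≡ s
toℕ-ix zero _ = refl
toℕ-ix {suc k} (suc s) (s≤s le) = cong suc (toℕ-ix s le)

ix-cycN : ∀ {k} s → s ≤ k → cycN {k} s zero ≡ ix s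
ix-cycN {k} s le = toℕ-injective (trans (toℕ-cycN s zero) (trans (m≤n⇒m%n≡m le) (sym (toℕ-ix s le))))

prod-ix : ∀ {k} (f : Fin (suc k) → Sign) → prod f ≡ prodN (λ s → f (ix s)) (suc k)
prod-ix {zero} f = ·-comm (f zero) ⊕
prod-ix {suc k} f = trans (cong (f zero ·_) (prod-ix (λ i → f (suc i))))
  (sym (prodN-shift (λ s → f (ix s)) (suc k)))

prod-cycN : ∀ {k} (f : Fin (suc k) → Sign) → prod f ≡ prodN (λ s → f (cycN s zero)) (suc k)
prod-cycN {k} f = trans (prod-ix f) (prodN-cong (suc k) (λ s lt → cong f (sym (ix-cycN s (NP.≤-pred lt)))))

prod-triangle : ∀ {K} → K ≡ 2 → (f : Fin (suc K) → Sign) (i : Fin (suc K)) → prod f ≡ f i · (f (cyc i) · f (cyc (cyc i)))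
prod-triangle refl f zero = cong (λ z → f zero · (f (suc zero) · z)) (·-⊕ʳ _)
prod-triangle refl f (suc zero) = trans (cong (λ z → f zero · (f (suc zero) · z)) (·-⊕ʳ _)) (·-rotate3 (f zero) (f (suc zero)) (f (suc (suc zero))))
prod-triangle refl f (suc (suc zero)) = trans (cong (λ z → f zero · (f (suc zero) · z)) (·-⊕ʳ _)) (trans (·-rotate3 (f zero) (f (suc zero)) (f (suc (suc zero)))) (·-rotate3 (f (suc zero)) (f (suc (suc zero))) (f zero)))

circle-1≤k : ∀ {V E : Set} {ends : E → V × V} → (∀ e → proj₁ (ends e) ≢ proj₂ (ends e)) →
             (C : Circle ends) → 1 ≤ k C
circle-1≤k {V} {E} {ends} loopless C = go (k C) (vtx C) (edg C) (joins C)
  where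
  go : ∀ k' (vt : Fin (suc k') → V) (ed : Fin (suc k') → E) → (∀ i → Joins ends (ed i) (vt i) (vt (cyc {k'} i))) → 1 ≤ k'
  go zero vt ed jn with jn zero
  ... | inj₁ eq = ⊥-elim (loopless (ed zero) (trans (cong proj₁ eq) (sym (cong proj₂ eq))))
  ... | inj₂ eq = ⊥-elim (loopless (ed zero) (trans (cong proj₁ eq) (sym (cong proj₂ eq))))
  go (suc k') _ _ _ = s≤s z≤n

inject₁≢fromℕ : ∀ {k} (i : Fin k) → inject₁ i ≢ fromℕ k
inject₁≢fromℕ i eq = fromℕ≢inject₁ (sym eq)

suc≢inject₁ : ∀ {K} (q : Fin K) → suc q ≢ inject₁ q
suc≢inject₁ q eq = NP.<-irrefl (sym (trans (cong toℕ eq) (toℕ-inject₁ q))) (NP.n<1+n (toℕ q))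

inject₁≡zero : ∀ {K} (q : Fin (suc K)) → inject₁ q ≡ zero → q ≡ zero
inject₁≡zero zero _ = refl

snocF : ∀ {K} {A : Set} → (Fin K → A) → A → Fin (suc K) → A
snocF {zero} f a zero = a
snocF {suc K} f a zero = f zero
snocF {suc K} f a (suc i) = snocF (λ j → f (suc j)) a i

snocF-inj : ∀ {K} {A : Set} (f : Fin K → A) a q → snocF f a (inject₁ q) ≡ f q
snocF-inj {suc K} f a zero = refl
snocF-inj {suc K} f a (suc q) = snocF-inj (λ j → f (suc j)) a q

snocF-last : ∀ {K} {A : Set} (f : Fin K → A) a → snocF f a (fromℕ K) ≡ a
snocF-last {zero} f a = refl
snocF-last {suc K} f a = snocF-last (λ j → f (suc j)) a

forward-closed⇒all : ∀ {K} (R : Fin (suc K) → Set) → R zero → (∀ a → R (inject₁ a) → R (suc a)) → ∀ q → R q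
forward-closed⇒all R r0 st zero = r0
forward-closed⇒all {suc K} R r0 st (suc q) = forward-closed⇒all (λ i → R (suc i)) (st zero r0) (λ a → st (suc a)) q

backward-closed⇒zero : ∀ {K} (R : Fin (suc K) → Set) → (∀ a → R (suc a) → R (inject₁ a)) → ∀ q → R q → R zero
backward-closed⇒zero R st zero r = r
backward-closed⇒zero {suc K} R st (suc q) r = st zero (backward-closed⇒zero (λ i → R (suc i)) (λ a → st (suc a)) q r)

sumF≥1 : ∀ {k} (f : Fin k → ℕ) a → 1 ≤ f a → 1 ≤ sumF f
sumF≥1 f zero h = NP.≤-trans h (NP.m≤m+n _ _)
sumF≥1 f (suc a) h = NP.≤-trans (sumF≥1 (λ i → f (suc i)) a h) (NP.m≤n+m _ _)

sumF≥2 : ∀ {k} (f : Fin k → ℕ) a b → a ≢ b → 1 ≤ f a → 1 ≤ f b → 2 ≤ sumF f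
sumF≥2 f zero zero ne ha hb = ⊥-elim (ne refl)
sumF≥2 f zero (suc b) ne ha hb = NP.+-mono-≤ ha (sumF≥1 (λ i → f (suc i)) b hb)
sumF≥2 f (suc a) zero ne ha hb = NP.+-mono-≤ hb (sumF≥1 (λ i → f (suc i)) a ha)
sumF≥2 f (suc a) (suc b) ne ha hb = NP.≤-trans (sumF≥2 (λ i → f (suc i)) a b (λ e → ne (cong suc e)) ha hb) (NP.m≤n+m _ _)

sumF≥3 : ∀ {k} (f : Fin k → ℕ) a b c → a ≢ b → b ≢ c → a ≢ c → 1 ≤ f a → 1 ≤ f b → 1 ≤ f c → 3 ≤ sumF f
sumF≥3 f zero zero c ab bc ac ha hb hc = ⊥-elim (ab refl)
sumF≥3 f zero (suc b) zero ab bc ac ha hb hc = ⊥-elim (ac refl)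
sumF≥3 f zero (suc b) (suc c) ab bc ac ha hb hc = NP.+-mono-≤ ha (sumF≥2 (λ i → f (suc i)) b c (λ e → bc (cong suc e)) hb hc)
sumF≥3 f (suc a) zero zero ab bc ac ha hb hc = ⊥-elim (bc refl)
sumF≥3 f (suc a) zero (suc c) ab bc ac ha hb hc = NP.+-mono-≤ hb (sumF≥2 (λ i → f (suc i)) a c (λ e → ac (cong suc e)) ha hc)
sumF≥3 f (suc a) (suc b) zero ab bc ac ha hb hc = NP.+-mono-≤ hc (sumF≥2 (λ i → f (suc i)) a b (λ e → ab (cong suc e)) ha hb)
sumF≥3 f (suc a) (suc b) (suc c) ab bc ac ha hb hc =
  NP.≤-trans (sumF≥3 (λ i → f (suc i)) a b c (λ e → ab (cong suc e)) (λ e → bc (cong suc e)) (λ e → ac (cong suc e)) ha hb hc) (NP.m≤n+m _ _)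

support₁ : ∀ {k} (f : Fin k → ℕ) → 1 ≤ sumF f → Σ (Fin k) λ a → 1 ≤ f a
support₁ {zero} f ()
support₁ {suc k} f h with 1 ℕ.≤? f zero
... | yes p = zero , p
... | no np with support₁ (λ i → f (suc i)) (subst (λ z → 1 ≤ z + sumF (λ i → f (suc i))) (NP.n<1⇒n≡0 (NP.≰⇒> np)) h)
... | a , q = suc a , q

support₂ : ∀ {k} (f : Fin k → ℕ) → (∀ i → f i ≤ 1) → 2 ≤ sumF f → Σ (Fin k) λ a → Σ (Fin k) λ b → a ≢ b × 1 ≤ f a × 1 ≤ f b
support₂ {zero} f le ()
support₂ {suc k} f le h with 1 ℕ.≤? f zero
... | yes p with support₁ (λ i → f (suc i)) (NP.≤-pred (subst (λ z → 2 ≤ z + sumF (λ i → f (suc i))) (NP.≤-antisym (le zero) p) h))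
... | a , q = zero , suc a , (λ ()) , p , q
support₂ {suc k} f le h | no np with support₂ (λ i → f (suc i)) (λ i → le (suc i)) (subst (λ z → 2 ≤ z + sumF (λ i → f (suc i))) (NP.n<1⇒n≡0 (NP.≰⇒> np)) h)
... | a , b , ab , qa , qb = suc a , suc b , (λ e → ab (suc-injective e)) , qa , qb

support₃ : ∀ {k} (f : Fin k → ℕ) → (∀ i → f i ≤ 1) → 3 ≤ sumF f →
       Σ (Fin k) λ a → Σ (Fin k) λ b → Σ (Fin k) λ c → a ≢ b × b ≢ c × a ≢ c × 1 ≤ f a × 1 ≤ f b × 1 ≤ f c
support₃ {zero} f le ()
support₃ {suc k} f le h with 1 ℕ.≤? f zero
... | yes p with support₂ (λ i → f (suc i)) (λ i → le (suc i)) (NP.≤-pred (subst (λ z → 3 ≤ z + sumF (λ i → f (suc i))) (NP.≤-antisym (le zero) p) h))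
... | a , b , ab , qa , qb = zero , suc a , suc b , (λ ()) , (λ e → ab (suc-injective e)) , (λ ()) , p , qa , qb
support₃ {suc k} f le h | no np with support₃ (λ i → f (suc i)) (λ i → le (suc i)) (subst (λ z → 3 ≤ z + sumF (λ i → f (suc i))) (NP.n<1⇒n≡0 (NP.≰⇒> np)) h)
... | a , b , c , ab , bc , ac , qa , qb , qc = suc a , suc b , suc c , (λ e → ab (suc-injective e)) ,
      (λ e → bc (suc-injective e)) , (λ e → ac (suc-injective e)) , qa , qb , qc

data Distinct {A : Set} : List A → Set where
  dnil : Distinct []
  dcons : ∀ {x xs} → x ∉ xs → Distinct xs → Distinct (x ∷ xs)

All≢⇒∉ : ∀ {A : Set} {f : A} {xs : List A} → All (_≢ f) xs → f ∉ xs
All≢⇒∉ (px ∷ a) (here refl) = px refl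
All≢⇒∉ (px ∷ a) (there x) = All≢⇒∉ a x

consB : ∀ {k} → Bool → (Fin k → Bool) → Fin (suc k) → Bool
consB b g zero = b
consB b g (suc i) = g i

∃-boolFun? : ∀ {ℓ} k (Q : (Fin k → Bool) → Set ℓ) → (∀ f g → (∀ i → f i ≡ g i) → Q f → Q g) → (∀ f → Dec (Q f)) →
         Dec (Σ (Fin k → Bool) Q)
∃-boolFun? zero Q resp dq with dq (λ ())
... | yes q = yes (_ , q)
... | no nq = no (λ { (f , qf) → nq (resp f (λ ()) (λ ()) qf) })
∃-boolFun? (suc k) Q resp dq with ∃-boolFun? k (λ g → Q (consB true g)) (λ f g e → resp _ _ (λ { zero → refl ; (suc i) → e i })) (λ g → dq _)
                          | ∃-boolFun? k (λ g → Q (consB false g)) (λ f g e → resp _ _ (λ { zero → refl ; (suc i) → e i })) (λ g → dq _)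
... | yes (g , q) | _ = yes (_ , q)
... | no _ | yes (g , q) = yes (_ , q)
... | no n1 | no n2 = no λ { (f , qf) → go f qf (f zero) refl }
  where
  go : ∀ f → Q f → ∀ b → f zero ≡ b → ⊥
  go f qf true e = n1 ((λ i → f (suc i)) , resp f _ (λ { zero → e ; (suc i) → refl }) qf)
  go f qf false e = n2 ((λ i → f (suc i)) , resp f _ (λ { zero → e ; (suc i) → refl }) qf)

¬¬× : ∀ {A B : Set} → ¬ ¬ A → ¬ ¬ B → ¬ ¬ (A × B)
¬¬× na nb k = na (λ a → nb (λ b → k (a , b)))

¬¬-decidable-Fin : ∀ k (A : Fin k → Set) → ¬ ¬ (∀ i → Dec (A i))
¬¬-decidable-Fin zero A c = c (λ ())
¬¬-decidable-Fin (suc k) A c = ¬¬× ¬¬-excluded-middle (¬¬-decidable-Fin k (λ i → A (suc i))) (λ { (d0 , ds) → c (λ { zero → d0 ; (suc i) → ds i }) })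

module Walks (S : SGraph) where
  Vx = Fin (n S)
  Ed = Fin (m S)
  en = ends S
  sg = σ S

  Jn : Ed → Vx → Vx → Set
  Jn = Joins en

  joins-sym : ∀ {e a b} → Jn e a b → Jn e b a
  joins-sym (inj₁ x) = inj₂ x
  joins-sym (inj₂ y) = inj₁ y

  joins-incidentˡ : ∀ {e a b} → Jn e a b → Incident S a e
  joins-incidentˡ (inj₁ x) = inj₁ (cong proj₁ x)
  joins-incidentˡ (inj₂ y) = inj₂ (cong proj₂ y)

  joins-incidentʳ : ∀ {e a b} → Jn e a b → Incident S b e
  joins-incidentʳ j = joins-incidentˡ (joins-sym j)

  joins-≢ : Loopless S → ∀ {e a b} → Jn e a b → a ≢ b
  joins-≢ lf {e} (inj₁ x) refl = lf e (trans (cong proj₁ x) (sym (cong proj₂ x)))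
  joins-≢ lf {e} (inj₂ y) refl = lf e (trans (cong proj₁ y) (sym (cong proj₂ y)))

  incident⇒joins : ∀ {e u v} → Incident S u e → Incident S v e → u ≢ v → Jn e u v
  incident⇒joins (inj₁ a) (inj₁ b) ne = ⊥-elim (ne (trans (sym a) b))
  incident⇒joins (inj₁ a) (inj₂ b) ne = inj₁ (cong₂ _,_ a b)
  incident⇒joins (inj₂ a) (inj₁ b) ne = inj₂ (cong₂ _,_ b a)
  incident⇒joins (inj₂ a) (inj₂ b) ne = ⊥-elim (ne (trans (sym a) b))

  joins-incident : ∀ {e a b c} → Jn e a b → Incident S c e → c ≡ a ⊎ c ≡ b
  joins-incident (inj₁ x) (inj₁ y) = inj₁ (trans (sym y) (cong proj₁ x))
  joins-incident (inj₁ x) (inj₂ y) = inj₂ (trans (sym y) (cong proj₂ x))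
  joins-incident (inj₂ x) (inj₁ y) = inj₂ (trans (sym y) (cong proj₁ x))
  joins-incident (inj₂ x) (inj₂ y) = inj₁ (trans (sym y) (cong proj₂ x))

  joins-functional : Loopless S → ∀ {e a b c} → Jn e a b → Jn e a c → b ≡ c
  joins-functional lf j1 j2 with joins-incident j1 (joins-incidentʳ j2)
  ... | inj₂ x = sym x
  ... | inj₁ x = ⊥-elim (joins-≢ lf j2 (sym x))

  opposite : Ed → Vx → Vx
  opposite e u with proj₁ (en e) ≟F u
  ... | yes _ = proj₂ (en e)
  ... | no _ = proj₁ (en e)

  joins-opposite : ∀ {e u} → Incident S u e → Jn e u (opposite e u)
  joins-opposite {e} {u} inc with proj₁ (en e) ≟F u
  ... | yes p = inj₁ (cong₂ _,_ p refl)
  ... | no np with inc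
  ... | inj₁ q = ⊥-elim (np q)
  ... | inj₂ q = inj₂ (cong₂ _,_ refl q)

  incident? : ∀ v e → Dec (Incident S v e)
  incident? v e with proj₁ (en e) ≟F v | proj₂ (en e) ≟F v
  ... | yes p | _ = yes (inj₁ p)
  ... | no _ | yes q = yes (inj₂ q)
  ... | no p | no q = no λ { (inj₁ x) → p x ; (inj₂ y) → q y }

  data Walk : Vx → Vx → Set where
    wnil : ∀ {u} → Walk u u
    wcons : ∀ {u v w} (e : Ed) → Jn e u v → Walk v w → Walk u w

  len : ∀ {u w} → Walk u w → ℕ
  len wnil = 0
  len (wcons e j p) = suc (len p)

  edges : ∀ {u w} → Walk u w → List Ed
  edges wnil = []
  edges (wcons e j p) = e ∷ edges p

  vertices : ∀ {u w} → Walk u w → List Vx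
  vertices {u} wnil = u ∷ []
  vertices {u} (wcons e j p) = u ∷ vertices p

  signW : ∀ {u w} → Walk u w → Sign
  signW wnil = ⊕
  signW (wcons e j p) = sg e · signW p

  _++W_ : ∀ {u v w} → Walk u v → Walk v w → Walk u w
  wnil ++W q = q
  wcons e j p ++W q = wcons e j (p ++W q)

  single : ∀ {e u v} → Jn e u v → Walk u v
  single {e} j = wcons e j wnil

  reverseW : ∀ {u w} → Walk u w → Walk w u
  reverseW wnil = wnil
  reverseW (wcons e j p) = reverseW p ++W single (joins-sym j)

  castW : ∀ {u u' w w'} → u ≡ u' → w ≡ w' → Walk u w → Walk u' w'
  castW refl refl p = p

  signW-cast : ∀ {u u' w w'} (a : u ≡ u') (b : w ≡ w') p → signW (castW a b p) ≡ signW p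
  signW-cast refl refl p = refl

  edges-++ : ∀ {u v w} (p : Walk u v) (q : Walk v w) → edges (p ++W q) ≡ edges p ++ edges q
  edges-++ wnil q = refl
  edges-++ (wcons e j p) q = cong (e ∷_) (edges-++ p q)

  signW-++ : ∀ {u v w} (p : Walk u v) (q : Walk v w) → signW (p ++W q) ≡ signW p · signW q
  signW-++ wnil q = refl
  signW-++ (wcons e j p) q = trans (cong (sg e ·_) (signW-++ p q)) (sym (·-assoc (sg e) _ _))

  len-++ : ∀ {u v w} (p : Walk u v) (q : Walk v w) → len (p ++W q) ≡ len p + len q
  len-++ wnil q = refl
  len-++ (wcons e j p) q = cong suc (len-++ p q)

  AllE : (Ed → Set) → ∀ {u w} → Walk u w → Set
  AllE P p = All P (edges p)

  all-++ : ∀ {P : Ed → Set} {u v w} (p : Walk u v) (q : Walk v w) → AllE P p → AllE P q → AllE P (p ++W q)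
  all-++ p q a b = subst (All _) (sym (edges-++ p q)) (AllP.++⁺ a b)

  all-cast : ∀ {P : Ed → Set} {u u' w w'} (a : u ≡ u') (b : w ≡ w') p → AllE P p → AllE P (castW a b p)
  all-cast refl refl p x = x

  all-rev : ∀ {P : Ed → Set} {u w} (p : Walk u w) → AllE P p → AllE P (reverseW p)
  all-rev wnil a = a
  all-rev (wcons e j p) (pe ∷ a) = all-++ (reverseW p) _ (all-rev p a) (pe ∷ [])

  all-mono : ∀ {P Q : Ed → Set} → (∀ e → P e → Q e) → ∀ {u w} (p : Walk u w) → AllE P p → AllE Q p
  all-mono f p a = All.map (λ {e} → f e) a

  reach→walk : ∀ {es u w} → Reach S es u w → Σ (Walk u w) (AllE es)
  reach→walk here = wnil , []
  reach→walk (step e r ese j) with reach→walk r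
  ... | p , a = p ++W single j , all-++ p (single j) a (ese ∷ [])

  walk→reach' : ∀ {es u v w} → Reach S es u v → (p : Walk v w) → AllE es p → Reach S es u w
  walk→reach' r wnil a = r
  walk→reach' r (wcons e j p) (x ∷ a) = walk→reach' (step e r x j) p a

  walk→reach : ∀ {es u w} → (p : Walk u w) → AllE es p → Reach S es u w
  walk→reach = walk→reach' here

  reach-mono : ∀ {es es' : Ed → Set} → (∀ e → es e → es' e) → ∀ {u w} → Reach S es u w → Reach S es' u w
  reach-mono f here = here
  reach-mono f (step e r x j) = step e (reach-mono f r) (f e x) j

  reach-sym : ∀ {es u w} → Reach S es u w → Reach S es w u
  reach-sym r with reach→walk r
  ... | p , a = walk→reach (reverseW p) (all-rev p a)

  reach-trans : ∀ {es u v w} → Reach S es u v → Reach S es v w → Reach S es u w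
  reach-trans r1 r2 with reach→walk r2
  ... | p , a = walk→reach' r1 p a

  vertexAt : ∀ {u w} (p : Walk u w) → Fin (suc (len p)) → Vx
  vertexAt {u} wnil _ = u
  vertexAt {u} (wcons e j p) zero = u
  vertexAt (wcons e j p) (suc i) = vertexAt p i

  edgeAt : ∀ {u w} (p : Walk u w) → Fin (len p) → Ed
  edgeAt (wcons e j p) zero = e
  edgeAt (wcons e j p) (suc i) = edgeAt p i

  edgeAt-joins : ∀ {u w} (p : Walk u w) i → Jn (edgeAt p i) (vertexAt p (inject₁ i)) (vertexAt p (suc i))
  edgeAt-joins (wcons e j wnil) zero = j
  edgeAt-joins (wcons e j (wcons e' j' p)) zero = j
  edgeAt-joins (wcons e j p) (suc i) = edgeAt-joins p i

  vertexAt-last : ∀ {u w} (p : Walk u w) → vertexAt p (fromℕ (len p)) ≡ w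
  vertexAt-last wnil = refl
  vertexAt-last (wcons e j p) = vertexAt-last p

  vertexAt-∈ : ∀ {u w} (p : Walk u w) i → vertexAt p i ∈ vertices p
  vertexAt-∈ wnil zero = here refl
  vertexAt-∈ (wcons e j p) zero = here refl
  vertexAt-∈ (wcons e j p) (suc i) = there (vertexAt-∈ p i)

  vertexAt-surjective : ∀ {u w v} (p : Walk u w) → v ∈ vertices p → Σ (Fin (suc (len p))) λ i → vertexAt p i ≡ v
  vertexAt-surjective wnil (here refl) = zero , refl
  vertexAt-surjective (wcons e j p) (here refl) = zero , refl
  vertexAt-surjective (wcons e j p) (there x) with vertexAt-surjective p x
  ... | i , eq = suc i , eq

  edgeAt-∈ : ∀ {u w} (p : Walk u w) i → edgeAt p i ∈ edges p
  edgeAt-∈ (wcons e j p) zero = here refl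
  edgeAt-∈ (wcons e j p) (suc i) = there (edgeAt-∈ p i)

  edgeAt-surjective : ∀ {u w f} (p : Walk u w) → f ∈ edges p → Σ (Fin (len p)) λ i → edgeAt p i ≡ f
  edgeAt-surjective (wcons e j p) (here refl) = zero , refl
  edgeAt-surjective (wcons e j p) (there x) with edgeAt-surjective p x
  ... | i , eq = suc i , eq

  vertexAt-injective : ∀ {u w} (p : Walk u w) → Distinct (vertices p) → ∀ i i' → vertexAt p i ≡ vertexAt p i' → i ≡ i'
  vertexAt-injective wnil d zero zero eq = refl
  vertexAt-injective (wcons e j p) d zero zero eq = refl
  vertexAt-injective (wcons e j p) (dcons nm d) zero (suc i') eq = ⊥-elim (nm (subst (_∈ vertices p) (sym eq) (vertexAt-∈ p i')))
  vertexAt-injective (wcons e j p) (dcons nm d) (suc i) zero eq = ⊥-elim (nm (subst (_∈ vertices p) eq (vertexAt-∈ p i)))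
  vertexAt-injective (wcons e j p) (dcons nm d) (suc i) (suc i') eq = cong suc (vertexAt-injective p d i i' eq)

  edgeAt-injective : ∀ {u w} (p : Walk u w) → Distinct (edges p) → ∀ i i' → edgeAt p i ≡ edgeAt p i' → i ≡ i'
  edgeAt-injective (wcons e j p) d zero zero eq = refl
  edgeAt-injective (wcons e j p) (dcons nm d) zero (suc i') eq = ⊥-elim (nm (subst (_∈ edges p) (sym eq) (edgeAt-∈ p i')))
  edgeAt-injective (wcons e j p) (dcons nm d) (suc i) zero eq = ⊥-elim (nm (subst (_∈ edges p) eq (edgeAt-∈ p i)))
  edgeAt-injective (wcons e j p) (dcons nm d) (suc i) (suc i') eq = cong suc (edgeAt-injective p d i i' eq)

  signW-edgeAt : ∀ {u w} (p : Walk u w) → signW p ≡ prod (λ i → sg (edgeAt p i))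
  signW-edgeAt wnil = refl
  signW-edgeAt (wcons e j p) = cong (sg e ·_) (signW-edgeAt p)

  start∈ : ∀ {u w} (p : Walk u w) → u ∈ vertices p
  start∈ wnil = here refl
  start∈ (wcons e j p) = here refl

  end∈ : ∀ {u w} (p : Walk u w) → w ∈ vertices p
  end∈ wnil = here refl
  end∈ (wcons e j p) = there (end∈ p)

  edge-endpoints : ∀ {u w f} (p : Walk u w) → f ∈ edges p → Σ Vx λ a → Σ Vx λ b → Jn f a b × a ∈ vertices p × b ∈ vertices p
  edge-endpoints (wcons e j p) (here refl) = _ , _ , j , here refl , there (start∈ p)
  edge-endpoints (wcons e j p) (there x) with edge-endpoints p x
  ... | a , b , jj , ma , mb = a , b , jj , there ma , there mb

  distinct-edges : Loopless S → ∀ {u w} (p : Walk u w) → Distinct (vertices p) → Distinct (edges p)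
  distinct-edges lf wnil d = dnil
  distinct-edges lf (wcons e j p) (dcons nm d) = dcons nin (distinct-edges lf p d)
    where
    nin : e ∉ edges p
    nin x with edge-endpoints p x
    ... | a , b , jj , ma , mb with joins-incident jj (joins-incidentˡ j)
    ... | inj₁ refl = nm ma
    ... | inj₂ refl = nm mb

  ∈-vertices-++⁺ˡ : ∀ {u v w x} (p : Walk u v) (q : Walk v w) → x ∈ vertices p → x ∈ vertices (p ++W q)
  ∈-vertices-++⁺ˡ wnil q (here refl) = start∈ q
  ∈-vertices-++⁺ˡ (wcons e j p) q (here refl) = here refl
  ∈-vertices-++⁺ˡ (wcons e j p) q (there m) = there (∈-vertices-++⁺ˡ p q m)

  ∈-vertices-++⁺ʳ : ∀ {u v w x} (p : Walk u v) (q : Walk v w) → x ∈ vertices q → x ∈ vertices (p ++W q)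
  ∈-vertices-++⁺ʳ wnil q m = m
  ∈-vertices-++⁺ʳ (wcons e j p) q m = there (∈-vertices-++⁺ʳ p q m)

  ∈-vertices-++⁻ : ∀ {u v w x} (p : Walk u v) (q : Walk v w) → x ∈ vertices (p ++W q) → x ∈ vertices p ⊎ x ∈ vertices q
  ∈-vertices-++⁻ wnil q m = inj₂ m
  ∈-vertices-++⁻ (wcons e j p) q (here refl) = inj₁ (here refl)
  ∈-vertices-++⁻ (wcons e j p) q (there m) with ∈-vertices-++⁻ p q m
  ... | inj₁ x = inj₁ (there x)
  ... | inj₂ y = inj₂ y

  ∈-vertices-reverse⁻ : ∀ {u w x} (p : Walk u w) → x ∈ vertices (reverseW p) → x ∈ vertices p
  ∈-vertices-reverse⁻ wnil m = m
  ∈-vertices-reverse⁻ (wcons e j p) m with ∈-vertices-++⁻ (reverseW p) _ m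
  ... | inj₁ x = there (∈-vertices-reverse⁻ p x)
  ... | inj₂ (here refl) = there (start∈ p)
  ... | inj₂ (there (here refl)) = here refl

  ∈-vertices-reverse⁺ : ∀ {u w x} (p : Walk u w) → x ∈ vertices p → x ∈ vertices (reverseW p)
  ∈-vertices-reverse⁺ wnil m = m
  ∈-vertices-reverse⁺ (wcons e j p) (here refl) = ∈-vertices-++⁺ʳ (reverseW p) (single (joins-sym j)) (there (here refl))
  ∈-vertices-reverse⁺ (wcons e j p) (there m) = ∈-vertices-++⁺ˡ (reverseW p) (single (joins-sym j)) (∈-vertices-reverse⁺ p m)

  ∈-edges-reverse⁺ : ∀ {u w f} (p : Walk u w) → f ∈ edges p → f ∈ edges (reverseW p)
  ∈-edges-reverse⁺ (wcons e j p) (here refl) = subst (_ ∈_) (sym (edges-++ (reverseW p) _))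
     (∈-++⁺ʳ (edges (reverseW p)) (here refl))
  ∈-edges-reverse⁺ (wcons e j p) (there m) = subst (_ ∈_) (sym (edges-++ (reverseW p) _))
     (∈-++⁺ˡ (∈-edges-reverse⁺ p m))

module SimpleWalks (S : SGraph) (lf : Loopless S) where
  open Walks S
  open import Data.List.Membership.DecPropositional (_≟F_ {n S}) using () renaming (_∈?_ to _∈V?_)
  open import Data.List.Membership.DecPropositional (_≟F_ {m S}) using () renaming (_∈?_ to _∈E?_)

  suffix : ∀ {P : Ed → Set} {u v w} (p : Walk v w) → u ∈ vertices p → Distinct (vertices p) → AllE P p →
           Σ (Walk u w) λ r → Distinct (vertices r) × AllE P r
  suffix wnil (here refl) d a = wnil , d , a
  suffix (wcons e j p) (here refl) d a = wcons e j p , d , a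
  suffix (wcons e j p) (there x) (dcons _ d) (_ ∷ a) = suffix p x d a

  shortcut : ∀ {P : Ed → Set} {u w} (p : Walk u w) → AllE P p →
            Σ (Walk u w) λ q → Distinct (vertices q) × AllE P q
  shortcut wnil a = wnil , dcons (λ ()) dnil , a
  shortcut {u = u} (wcons e j p) (pe ∷ a) with shortcut p a
  ... | q , d , aq with u ∈V? vertices q
  ... | yes mem = suffix q mem d aq
  ... | no nm = wcons e j q , dcons nm d , pe ∷ aq

  splitAt : ∀ {u v w} (p : Walk v w) → u ∈ vertices p →
            Σ (Walk v u) λ r1 → Σ (Walk u w) λ r2 → (len r1 + len r2 ≡ len p) × (signW p ≡ signW r1 · signW r2)
  splitAt wnil (here refl) = wnil , wnil , refl , refl
  splitAt (wcons e j p) (here refl) = wnil , wcons e j p , refl , refl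
  splitAt (wcons e j p) (there x) with splitAt p x
  ... | r1 , r2 , l , s = wcons e j r1 , r2 , cong suc l , trans (cong (sg e ·_) s) (sym (·-assoc (sg e) _ _))

  CycleSplit : ∀ {v w} → Walk v w → Set
  CycleSplit {v} {w} q = Σ Vx λ x → Σ (Walk v x) λ p1 → Σ (Walk x x) λ c → Σ (Walk x w) λ p2 →
     (1 ≤ len c) × (len p1 + len c + len p2 ≡ len q) × (signW q ≡ signW c · signW (p1 ++W p2))

  simple-or-split : ∀ {v w} (q : Walk v w) → Distinct (vertices q) ⊎ CycleSplit q
  simple-or-split wnil = inj₁ (dcons (λ ()) dnil)
  simple-or-split {v} (wcons e j q) with simple-or-split q
  ... | inj₂ (x , p1 , c , p2 , l1 , l2 , s) =
        inj₂ (x , wcons e j p1 , c , p2 , l1 , cong suc l2 ,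
              trans (cong (sg e ·_) s) (trans (sym (·-assoc (sg e) _ _))
                (trans (cong (_· signW (p1 ++W p2)) (·-comm (sg e) (signW c))) (·-assoc (signW c) (sg e) _))))
  ... | inj₁ d with v ∈V? vertices q
  ... | no nm = inj₁ (dcons nm d)
  ... | yes mem = let (r1 , r2 , l , s) = splitAt q mem in
        inj₂ (v , wnil , wcons e j r1 , r2 , s≤s z≤n , cong suc l ,
            trans (cong (sg e ·_) s) (sym (·-assoc (sg e) _ _)))

  module _ {f a b} (j : Jn f a b) (q : Walk b a) (d : Distinct (vertices q)) (nf : f ∉ edges q) where
    private
      p = wcons f j q
    closingVertex : Fin (suc (len q)) → Vx
    closingVertex i = vertexAt p (inject₁ i)

    closingVertex-injective : ∀ i i' → closingVertex i ≡ closingVertex i' → i ≡ i'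
    closingVertex-injective zero zero eq = refl
    closingVertex-injective zero (suc i') eq = ⊥-elim (inject₁≢fromℕ i' (vertexAt-injective q d _ _ (trans (sym eq) (sym (vertexAt-last q)))))
    closingVertex-injective (suc i) zero eq = ⊥-elim (inject₁≢fromℕ i (vertexAt-injective q d _ _ (trans eq (sym (vertexAt-last q)))))
    closingVertex-injective (suc i) (suc i') eq = cong suc (inject₁-injective (vertexAt-injective q d _ _ eq))

    closing-joins : ∀ i → Jn (edgeAt p i) (closingVertex i) (closingVertex (cyc i))
    closing-joins i with view i
    ... | ‵fromℕ = subst (Jn (edgeAt p (fromℕ (len q))) (closingVertex (fromℕ (len q))))
                         (trans (vertexAt-last q) (cong closingVertex (sym (cyc-last (len q))))) (edgeAt-joins p (fromℕ (len q)))
    ... | ‵inject₁ i' = subst (Jn (edgeAt p (inject₁ i')) (closingVertex (inject₁ i'))) (cong closingVertex (sym (cyc-inject₁ i')))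
                         (edgeAt-joins p (inject₁ i'))

    closeUp : CircleΣ S
    closeUp = record { k = len q ; vtx = closingVertex ; edg = edgeAt p ; vinj = closingVertex-injective
                 ; einj = edgeAt-injective p (dcons nf (distinct-edges lf q d)) ; joins = closing-joins }

    closeUp-edge : InCE S closeUp f
    closeUp-edge = zero , refl

    closeUp-sign : sgnC S closeUp ≡ signW p
    closeUp-sign = sym (signW-edgeAt p)

    closeUp-vertex : ∀ {v} → v ∈ vertices q → InCV S closeUp v
    closeUp-vertex {v} mem with vertexAt-surjective q mem
    ... | i , eq with view i
    ... | ‵fromℕ = zero , trans (sym (vertexAt-last q)) eq
    ... | ‵inject₁ i' = suc i' , eq

    closeUp-edge⁻ : ∀ {e} → InCE S closeUp e → e ≡ f ⊎ e ∈ edges q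
    closeUp-edge⁻ (zero , eq) = inj₁ (sym eq)
    closeUp-edge⁻ (suc i , eq) = inj₂ (subst (_∈ edges q) eq (edgeAt-∈ q i))

  circleThrough : ∀ {f a b} → Jn f a b → (p : Walk b a) → AllE (_≢ f) p → Σ (CircleΣ S) λ C → InCE S C f
  circleThrough j p al with shortcut p al
  ... | q , d , aq = closeUp j q d (All≢⇒∉ aq) , closeUp-edge j q d (All≢⇒∉ aq)

  digon-sign : ∀ {e u v} (j : Jn e u v) (q : Walk v u) → Distinct (vertices q) → e ∈ edges q → signW (wcons e j q) ≡ ⊕
  digon-sign j (wcons e' j' q') (dcons nm d) (here refl) with joins-incident j' (joins-incidentˡ j)
  ... | inj₁ eq = ⊥-elim (joins-≢ lf j eq)
  ... | inj₂ refl with q'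
  ... | wnil = trans (sym (·-assoc (sg e') (sg e') ⊕)) (trans (·-⊕ʳ _) (·-self (sg e')))
  ... | wcons e'' j'' q'' with d
  ... | dcons nm' _ = ⊥-elim (nm' (end∈ q''))
  digon-sign {e} {u} {v} j (wcons e' j' q') (dcons nm d) (there x) with edge-endpoints q' x
  ... | a' , b' , jj , ma , mb with joins-incident jj (joins-incidentʳ j)
  ... | inj₁ refl = ⊥-elim (nm ma)
  ... | inj₂ refl = ⊥-elim (nm mb)

  -- Split at a repeated vertex into two shorter closed walks; a closed walk with distinct vertices
  -- is a circle, or runs back along its first edge.
  closedWalk-positive : Balanced S → ∀ fuel {u} (p : Walk u u) → len p ≤ fuel → signW p ≡ ⊕
  closedWalk-positive bal fuel wnil le = refl
  closedWalk-positive bal zero (wcons e j q) ()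
  closedWalk-positive bal (suc fuel) (wcons e j q) (s≤s le) with simple-or-split q
  ... | inj₂ (x , p1 , c , p2 , l1 , l2 , s) =
      trans (cong (sg e ·_) s) (trans (sym (·-assoc (sg e) _ _))
        (trans (cong (_· signW (p1 ++W p2)) (·-comm (sg e) (signW c)))
        (trans (·-assoc (signW c) (sg e) _)
        (cong₂ _·_ (closedWalk-positive bal fuel c lc) (closedWalk-positive bal fuel (wcons e j (p1 ++W p2)) lr)))))
    where
    lc : len c ≤ fuel
    lc = NP.≤-trans (NP.≤-trans (NP.m≤n+m (len c) (len p1)) (NP.m≤m+n _ (len p2))) (NP.≤-trans (NP.≤-reflexive l2) le)
    lr : suc (len (p1 ++W p2)) ≤ fuel
    lr = NP.≤-trans (NP.≤-reflexive (cong suc (len-++ p1 p2)))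
         (NP.≤-trans (lem (len p1) (len c) (len p2) l1) (NP.≤-trans (NP.≤-reflexive l2) le))
      where
      lem : ∀ a b c → 1 ≤ b → suc (a + c) ≤ a + b + c
      lem a (suc b) c _ = subst (suc (a + c) ≤_) (sym (cong (_+ c) (NP.+-suc a b))) (s≤s (NP.+-monoˡ-≤ c (NP.m≤m+n a b)))
  ... | inj₁ d with q
  ... | wnil = ⊥-elim (joins-≢ lf j refl)
  ... | wcons e' j' q' with e ∈E? edges (wcons e' j' q')
  ... | yes mem = digon-sign j (wcons e' j' q') d mem
  ... | no nm = trans (sym (closeUp-sign j (wcons e' j' q') d nm)) (bal (closeUp j (wcons e' j' q') d nm))

  distinct-++ : ∀ {u v w} (p : Walk u v) (q : Walk v w) → Distinct (vertices p) → Distinct (vertices q) →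
                (∀ x → x ∈ vertices p → x ∈ vertices q → x ≡ v) → Distinct (vertices (p ++W q))
  distinct-++ wnil q dp dq c = dq
  distinct-++ (wcons e j p) q (dcons nu dp) dq c = dcons nin (distinct-++ p q dp dq (λ x a b → c x (there a) b))
    where
    nin : _ ∉ vertices (p ++W q)
    nin m with ∈-vertices-++⁻ p q m
    ... | inj₁ x = nu x
    ... | inj₂ y = nu (subst (_∈ vertices p) (sym (c _ (here refl) y)) (end∈ p))

  distinct-reverse : ∀ {u w} (p : Walk u w) → Distinct (vertices p) → Distinct (vertices (reverseW p))
  distinct-reverse wnil d = d
  distinct-reverse (wcons e j p) (dcons nu d) =
    distinct-++ (reverseW p) (single (joins-sym j)) (distinct-reverse p d) (dcons (λ { (here eq) → joins-≢ lf j (sym eq) ; (there ()) }) (dcons (λ ()) dnil))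
      (λ { x a (here refl) → refl ; x a (there (here refl)) → ⊥-elim (nu (∈-vertices-reverse⁻ p a)) ; x a (there (there ())) })

  TwoEdgesAt : ∀ {u w} → Walk u w → Vx → Set
  TwoEdgesAt p v = Σ Ed λ e1 → Σ Ed λ e2 → e1 ∈ edges p × e2 ∈ edges p × e1 ≢ e2 × Incident S v e1 × Incident S v e2

  second-twoEdges : ∀ {u u1 w} e (j : Jn e u u1) (p : Walk u1 w) → u ∉ vertices p → u1 ≢ w → TwoEdgesAt (wcons e j p) u1
  second-twoEdges e j wnil nu nw = ⊥-elim (nw refl)
  second-twoEdges e j (wcons e' j' p) nu nw = e , e' , here refl , there (here refl) , ne , joins-incidentʳ j , joins-incidentˡ j'
    where
    ne : e ≢ e'
    ne refl = nu (there (subst (_∈ vertices p) (sym (joins-functional lf (joins-sym j) j')) (start∈ p)))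

  internal-twoEdges : ∀ {u w v} (p : Walk u w) → Distinct (vertices p) → v ∈ vertices p → v ≢ u → v ≢ w → TwoEdgesAt p v
  internal-twoEdges wnil d (here refl) nu nw = ⊥-elim (nu refl)
  internal-twoEdges (wcons e j p) d (here refl) nu nw = ⊥-elim (nu refl)
  internal-twoEdges {v = v} (wcons {v = u1} e j p) (dcons nu' d) (there m) nu nw with v ≟F u1
  ... | yes refl = second-twoEdges e j p nu' nw
  ... | no ne = let (e1 , e2 , m1 , m2 , r) = internal-twoEdges p d m ne nw in e1 , e2 , there m1 , there m2 , r

  simple-length<n : ∀ {u w} (q : Walk u w) → Distinct (vertices q) → len q < n S
  simple-length<n q d = injective⇒≤ (λ {i} {j} → vertexAt-injective q d i j)

module LineGraph (S : SGraph) (lf : Loopless S) where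
  open Walks S
  open SimpleWalks S lf

  incident⇒T : ∀ {v e} → Incident S v e → T (incB S v e)
  incident⇒T {v} {e} (inj₁ p) = Equivalence.from (T-∨ {⌊ proj₁ (en e) ≟F v ⌋} {⌊ proj₂ (en e) ≟F v ⌋})
                             (inj₁ (fromWitness {a? = proj₁ (en e) ≟F v} p))
  incident⇒T {v} {e} (inj₂ p) = Equivalence.from (T-∨ {⌊ proj₁ (en e) ≟F v ⌋} {⌊ proj₂ (en e) ≟F v ⌋})
                             (inj₂ (fromWitness {a? = proj₂ (en e) ≟F v} p))

  T⇒incident : ∀ {v e} → T (incB S v e) → Incident S v e
  T⇒incident {v} {e} t with Equivalence.to (T-∨ {⌊ proj₁ (en e) ≟F v ⌋} {⌊ proj₂ (en e) ≟F v ⌋}) t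
  ... | inj₁ x = inj₁ (toWitness {a? = proj₁ (en e) ≟F v} x)
  ... | inj₂ y = inj₂ (toWitness {a? = proj₂ (en e) ≟F v} y)

  commonVertex : LEdge S → Vx
  commonVertex ((a , b , v) , _) = v

  lineEdge-props : (l : LEdge S) → Incident S (commonVertex l) (proj₁ (lends S l)) × Incident S (commonVertex l) (proj₂ (lends S l))
                              × proj₁ (lends S l) ≢ proj₂ (lends S l)
  lineEdge-props ((a , b , v) , t) with Equivalence.to T-∧ t
  ... | lt , r with Equivalence.to T-∧ r
  ... | ia , ib = T⇒incident ia , T⇒incident ib , λ eq → NP.<-irrefl (cong toℕ eq) (NP.<ᵇ⇒< (toℕ a) (toℕ b) lt)

  mkLineEdge : (e f : Ed) (v : Vx) → e ≢ f → Incident S v e → Incident S v f →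
         Σ (LEdge S) λ l → Joins (lends S) l e f × commonVertex l ≡ v
  mkLineEdge e f v ne ie if with toℕ e ℕ.<? toℕ f
  ... | yes lt = ((e , f , v) , Equivalence.from T-∧ (NP.<⇒<ᵇ lt , Equivalence.from T-∧ (incident⇒T ie , incident⇒T if))) ,
                 inj₁ refl , refl
  ... | no nlt = ((f , e , v) , Equivalence.from T-∧ (NP.<⇒<ᵇ lt' , Equivalence.from T-∧ (incident⇒T if , incident⇒T ie))) ,
                 inj₂ refl , refl
    where
    lt' : toℕ f < toℕ e
    lt' = NP.≤∧≢⇒< (NP.≮⇒≥ nlt) (λ eq → ne (toℕ-injective (sym eq)))

  record LineCircleData : Set where
    field
      length : ℕ
      edge : Fin (suc length) → Ed
      meet : Fin (suc length) → Vx
      edge-injective : ∀ i j → edge i ≡ edge j → i ≡ j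
      meet-incident : ∀ i → Incident S (meet i) (edge i)
      meet-incident-next : ∀ i → Incident S (meet i) (edge (cyc i))
      1≤length : 1 ≤ length
      -- a digon of L(Γ) has two L-edges between the same two edges of Γ
      digon-separated : ∀ i → cyc (cyc i) ≡ i → meet i ≢ meet (cyc i)

  module _ (D : LineCircleData) where
    open LineCircleData D
    private
      nx : ∀ i → edge i ≢ edge (cyc i)
      nx i eq = cyc≢id 1≤length i (sym (edge-injective _ _ eq))
      le : ∀ i → Σ (LEdge S) λ l → Joins (lends S) l (edge i) (edge (cyc i)) × commonVertex l ≡ meet i
      le i = mkLineEdge (edge i) (edge (cyc i)) (meet i) (nx i) (meet-incident i) (meet-incident-next i)

      einj' : ∀ i j → proj₁ (le i) ≡ proj₁ (le j) → i ≡ j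
      einj' i j eq = go (proj₁ (proj₂ (le i))) (proj₁ (proj₂ (le j)))
        where
        ev : meet i ≡ meet j
        ev = trans (sym (proj₂ (proj₂ (le i)))) (trans (cong commonVertex eq) (proj₂ (proj₂ (le j))))
        le≡ : lends S (proj₁ (le i)) ≡ lends S (proj₁ (le j))
        le≡ = cong (lends S) eq
        cross : edge i ≡ edge (cyc j) → edge (cyc i) ≡ edge j → i ≡ j
        cross a b = ⊥-elim (digon-separated j (trans (cong cyc (sym ij)) ji) (trans (sym ev) (cong meet ij)))
          where
          ij : i ≡ cyc j
          ij = edge-injective _ _ a
          ji : cyc i ≡ j
          ji = edge-injective _ _ b
        go : Joins (lends S) (proj₁ (le i)) (edge i) (edge (cyc i)) → Joins (lends S) (proj₁ (le j)) (edge j) (edge (cyc j)) → i ≡ j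
        go (inj₁ a) (inj₁ b) = edge-injective _ _ (cong proj₁ (trans (sym a) (trans le≡ b)))
        go (inj₁ a) (inj₂ b) = cross (cong proj₁ (trans (sym a) (trans le≡ b))) (cong proj₂ (trans (sym a) (trans le≡ b)))
        go (inj₂ a) (inj₁ b) = cross (cong proj₂ (trans (sym a) (trans le≡ b))) (cong proj₁ (trans (sym a) (trans le≡ b)))
        go (inj₂ a) (inj₂ b) = edge-injective _ _ (cong proj₂ (trans (sym a) (trans le≡ b)))

    lineCircle : CircleL S
    lineCircle = record { k = length ; vtx = edge ; edg = λ i → proj₁ (le i) ; vinj = edge-injective ; einj = einj'
                    ; joins = λ i → proj₁ (proj₂ (le i)) }

    lineCircle-positive : LineConsistent S → prod (λ i → sg (edge i)) ≡ ⊕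
    lineCircle-positive lc = lc lineCircle

  lineConsistent⇒balanced : LineConsistent S → Balanced S
  lineConsistent⇒balanced lc C = lineCircle-positive D lc
    where
    D : LineCircleData
    D = record { length = k C ; edge = edg C ; meet = λ i → vtx C (cyc i) ; edge-injective = einj C
               ; meet-incident = λ i → joins-incidentʳ (joins C i) ; meet-incident-next = λ i → joins-incidentˡ (joins C (cyc i))
               ; 1≤length = circle-1≤k lf C
               ; digon-separated = λ i e1 e2 → cyc≢id (circle-1≤k lf C) i (vinj C _ _ (trans e2 (cong (vtx C) e1))) }

  star-positive : LineConsistent S → ∀ {v a b c} → Incident S v a → Incident S v b → Incident S v c →
        a ≢ b → b ≢ c → a ≢ c → sg a · (sg b · sg c) ≡ ⊕
  star-positive lc {v} {a} {b} {c} ia ib ic ab bc ac =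
    trans (cong (λ z → sg a · (sg b · z)) (sym (·-⊕ʳ (sg c)))) (lineCircle-positive D lc)
    where
    x : Fin 3 → Ed
    x zero = a
    x (suc zero) = b
    x (suc (suc zero)) = c
    xi : ∀ i j → x i ≡ x j → i ≡ j
    xi zero zero e = refl
    xi zero (suc zero) e = ⊥-elim (ab e)
    xi zero (suc (suc zero)) e = ⊥-elim (ac e)
    xi (suc zero) zero e = ⊥-elim (ab (sym e))
    xi (suc zero) (suc zero) e = refl
    xi (suc zero) (suc (suc zero)) e = ⊥-elim (bc e)
    xi (suc (suc zero)) zero e = ⊥-elim (ac (sym e))
    xi (suc (suc zero)) (suc zero) e = ⊥-elim (bc (sym e))
    xi (suc (suc zero)) (suc (suc zero)) e = refl
    inc : ∀ i → Incident S v (x i)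
    inc zero = ia
    inc (suc zero) = ib
    inc (suc (suc zero)) = ic
    D : LineCircleData
    D = record { length = 2 ; edge = x ; meet = λ _ → v ; edge-injective = xi ; meet-incident = inc ; meet-incident-next = λ i → inc (cyc i)
               ; 1≤length = s≤s z≤n ; digon-separated = λ i e → ⊥-elim (cyc²≢id (s≤s (s≤s z≤n)) i e) }

  insertion-positive : LineConsistent S → ∀ {f x y b'} (j : Jn f x y) (Q : Walk y x) → Distinct (vertices Q) → f ∉ edges Q →
           b' ≢ f → b' ∉ edges Q → Incident S x b' → sg b' · signW (wcons f j Q) ≡ ⊕
  insertion-positive lc {f} {x} {y} {b'} j Q d nf bf bQ ib =
    trans (cong (sg b' ·_) (signW-edgeAt p)) (lineCircle-positive D lc)
    where
    p = wcons f j Q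
    dE : Distinct (edges p)
    dE = dcons nf (distinct-edges lf Q d)
    lQ : 1 ≤ len Q
    lQ = lQ' j Q
      where
      lQ' : ∀ {x y} → Jn f x y → (Q : Walk y x) → 1 ≤ len Q
      lQ' j wnil = ⊥-elim (joins-≢ lf j refl)
      lQ' j (wcons _ _ _) = s≤s z≤n
    x' : Fin (suc (suc (len Q))) → Ed
    x' zero = b'
    x' (suc i) = edgeAt p i
    w' : Fin (suc (suc (len Q))) → Vx
    w' zero = x
    w' (suc i) = vertexAt p (suc i)
    bnot : ∀ i → b' ≢ edgeAt p i
    bnot zero e = bf e
    bnot (suc i) e = bQ (subst (_∈ edges Q) (sym e) (edgeAt-∈ Q i))
    xi : ∀ i i' → x' i ≡ x' i' → i ≡ i'
    xi zero zero e = refl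
    xi zero (suc i') e = ⊥-elim (bnot i' e)
    xi (suc i) zero e = ⊥-elim (bnot i (sym e))
    xi (suc i) (suc i') e = cong suc (edgeAt-injective p dE i i' e)
    i1 : ∀ i → Incident S (w' i) (x' i)
    i1 zero = ib
    i1 (suc i) = joins-incidentʳ (edgeAt-joins p i)
    i2 : ∀ i → Incident S (w' i) (x' (cyc i))
    i2 zero = subst (λ z → Incident S x (x' z)) (sym (cyc-inject₁ {suc (len Q)} zero)) (joins-incidentˡ j)
    i2 (suc i) with view i
    ... | ‵fromℕ = subst₂ (λ a z → Incident S a (x' z)) (sym (vertexAt-last p)) (sym (cyc-last (suc (len Q)))) ib
    ... | ‵inject₁ i' = subst (λ z → Incident S (vertexAt p (suc (inject₁ i'))) (x' z)) (sym (cyc-inject₁ (suc i')))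
                       (joins-incidentˡ (edgeAt-joins p (suc i')))
    D : LineCircleData
    D = record { length = suc (len Q) ; edge = x' ; meet = w' ; edge-injective = xi ; meet-incident = i1 ; meet-incident-next = i2
               ; 1≤length = s≤s z≤n ; digon-separated = λ i e → ⊥-elim (cyc²≢id (s≤s lQ) i e) }

module CircleStructure (S : SGraph) (lf : Loopless S) where
  open Walks S
  open SimpleWalks S lf
  open LineGraph S lf

  module Chain {K} (A : Fin (suc K) → Vx) (st : ∀ i → Walk (A i) (A (cyc i))) where
    chainW : (p : Fin (suc K)) (t d : ℕ) → Walk (A (cycN t p)) (A (cycN (d + t) p))
    chainW p t zero = wnil
    chainW p t (suc d) = chainW p t d ++W st (cycN (d + t) p)

    chain-all : ∀ {P : Ed → Set} p t d → (∀ s → t ≤ s → s < d + t → AllE P (st (cycN s p))) → AllE P (chainW p t d)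
    chain-all p t zero h = []
    chain-all p t (suc d) h = all-++ (chainW p t d) _ (chain-all p t d (λ s a b → h s a (NP.m≤n⇒m≤1+n b)))
                                     (h (d + t) (NP.m≤n+m t d) NP.≤-refl)

    chain-sgn : ∀ p d → signW (chainW p 0 d) ≡ prodN (λ s → signW (st (cycN s p))) d
    chain-sgn p zero = refl
    chain-sgn p (suc d) = trans (signW-++ (chainW p 0 d) _)
      (cong₂ _·_ (chain-sgn p d) (cong (λ z → signW (st (cycN z p))) (NP.+-identityʳ d)))

    eqC : A (cycN (suc K + 0) zero) ≡ A zero
    eqC = cong A (trans (cong (λ z → cycN z zero) (NP.+-identityʳ (suc K))) (cycN-full zero))

    closedW : Walk (A zero) (A zero)
    closedW = castW refl eqC (chainW zero 0 (suc K))

    closed-sgn : signW closedW ≡ prod (λ i → signW (st i))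
    closed-sgn = trans (signW-cast refl eqC (chainW zero 0 (suc K))) (trans (chain-sgn zero (suc K)) (sym (prod-cycN (λ i → signW (st i)))))

    arcW : (p : Fin (suc K)) → Walk (A (cyc p)) (A p)
    arcW p = castW refl (cong A (trans (cong (λ z → cycN z p) (NP.+-comm K 1)) (cycN-full p))) (chainW p 1 K)

    arc-all : ∀ {P : Ed → Set} p → (∀ s → 1 ≤ s → s ≤ K → AllE P (st (cycN s p))) → AllE P (arcW p)
    arc-all p h = all-cast refl _ (chainW p 1 K)
       (chain-all p 1 K (λ s a b → h s a (NP.≤-pred (subst (s <_) (NP.+-comm K 1) b))))

    pathW : (p : Fin (suc K)) (t : ℕ) → Walk (A p) (A (cycN t p))
    pathW p t = castW refl (cong (λ z → A (cycN z p)) (NP.+-identityʳ t)) (chainW p 0 t)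

    path-all : ∀ {P : Ed → Set} p t → (∀ s → s < t → AllE P (st (cycN s p))) → AllE P (pathW p t)
    path-all p t h = all-cast refl _ (chainW p 0 t) (chain-all p 0 t (λ s a b → h s (subst (s <_) (NP.+-identityʳ t) b)))

    segW : (p : Fin (suc K)) (t : ℕ) → 1 ≤ t → Walk (A (cyc p)) (A (cycN t p))
    segW p (suc t) _ = castW refl (cong (λ z → A (cycN z p)) (NP.+-comm t 1)) (chainW p 1 t)

    seg-all : ∀ {P : Ed → Set} p t (le : 1 ≤ t) → (∀ s → 1 ≤ s → s < t → AllE P (st (cycN s p))) → AllE P (segW p t le)
    seg-all p (suc t) le h = all-cast refl _ (chainW p 1 t) (chain-all p 1 t (λ s a b → h s a (subst (s <_) (NP.+-comm t 1) b)))

  module Circ (C : CircleΣ S) where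
    K = k C
    1≤K : 1 ≤ K
    1≤K = circle-1≤k lf C
    st : ∀ i → Walk (vtx C i) (vtx C (cyc i))
    st i = single (joins C i)
    open Chain (vtx C) st public

    prev : Fin (suc K) → Fin (suc K)
    prev = cycN K

    cyc-prev : ∀ p → cyc (prev p) ≡ p
    cyc-prev p = cycN-full p

    prev-cyc : ∀ p → prev (cyc p) ≡ p
    prev-cyc p = trans (cycN-comm K p) (cycN-full p)

    prev≢ : ∀ p → prev p ≢ p
    prev≢ p = cycN≢id K p 1≤K NP.≤-refl

    incident-edge : ∀ p → Incident S (vtx C p) (edg C p)
    incident-edge p = joins-incidentˡ (joins C p)

    incident-prevEdge : ∀ p → Incident S (vtx C p) (edg C (prev p))
    incident-prevEdge p = subst (λ z → Incident S (vtx C z) (edg C (prev p))) (cyc-prev p) (joins-incidentʳ (joins C (prev p)))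

    edge≢prevEdge : ∀ p → edg C p ≢ edg C (prev p)
    edge≢prevEdge p eq = prev≢ p (sym (einj C _ _ eq))

    incident-edges : ∀ p q → Incident S (vtx C p) (edg C q) → q ≡ p ⊎ q ≡ prev p
    incident-edges p q inc with joins-incident (joins C q) inc
    ... | inj₁ x = inj₁ (sym (vinj C _ _ x))
    ... | inj₂ y = inj₂ (trans (sym (prev-cyc q)) (cong prev (sym (vinj C _ _ y))))

    InCE? : ∀ e → Dec (InCE S C e)
    InCE? e = any? (λ i → edg C i ≟F e)

    InCV? : ∀ v → Dec (InCV S C v)
    InCV? v = any? (λ i → vtx C i ≟F v)

    isSub : IsSub S (circSub S C)
    isSub e (i , refl) with joins C i
    ... | inj₁ x = subst (λ z → InCV S C (proj₁ z) × InCV S C (proj₂ z)) (sym x) ((i , refl) , (cyc i , refl))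
    ... | inj₂ x = subst (λ z → InCV S C (proj₁ z) × InCV S C (proj₂ z)) (sym x) ((cyc i , refl) , (i , refl))

    endC : ∀ {e a b} → InCE S C e → Jn e a b → InCV S C b
    endC {e} ie (inj₁ x) = subst (InCV S C) (cong proj₂ x) (proj₂ (isSub e ie))
    endC {e} ie (inj₂ x) = subst (InCV S C) (cong proj₁ x) (proj₁ (isSub e ie))

    walkC : ∀ p q → Σ (Walk (vtx C p) (vtx C q)) (AllE (InCE S C))
    walkC p q with cycN-surj p q
    ... | t , tk , refl = pathW p t , path-all p t (λ s _ → (cycN s p , refl) ∷ [])

    connected : Connected S (circSub S C)
    connected u w (p , refl) (q , refl) = walk→reach (proj₁ (walkC p q)) (proj₂ (walkC p q))

    arcAvoid : ∀ p → Σ (Walk (vtx C (cyc p)) (vtx C p)) (AllE (_≢ edg C p))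
    arcAvoid p = arcW p , arc-all p (λ s a b → (λ eq → cycN≢id s p a b (einj C _ _ eq)) ∷ [])

    onC→walk : ∀ {f} → InCE S C f → Σ Vx λ a → Σ Vx λ b → Jn f a b × Σ (Walk b a) (AllE (_≢ f))
    onC→walk (p , refl) = vtx C p , vtx C (cyc p) , joins C p , arcAvoid p

    baseReach : ∀ p q → q ≢ p → Σ (Walk (vtx C (cyc p)) (vtx C q)) (AllE (se (delV S (circSub S C) (vtx C p))))
    baseReach p q ne with cycN-surj p q
    ... | zero , tk , refl = ⊥-elim (ne refl)
    ... | suc t , tk , refl = segW p (suc t) (s≤s z≤n) ,
          seg-all p (suc t) (s≤s z≤n) (λ s a b → ((cycN s p , refl) , noInc s a b) ∷ [])
      where
      noInc : ∀ s → 1 ≤ s → s < suc t → ¬ Incident S (vtx C p) (edg C (cycN s p))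
      noInc s a b inc with joins-incident (joins C (cycN s p)) inc
      ... | inj₁ x = cycN≢id s p a (NP.≤-trans (NP.n≤1+n s) (NP.≤-trans b tk)) (sym (vinj C _ _ x))
      ... | inj₂ y = cycN≢id (suc s) p (s≤s z≤n) (NP.≤-trans b tk) (sym (vinj C _ _ y))

    connected-minus : ∀ p → Connected S (delV S (circSub S C) (vtx C p))
    connected-minus p u w ((q , refl) , nu) ((q' , refl) , nw) =
      reach-trans (reach-sym (walk→reach (proj₁ (baseReach p q nq)) (proj₂ (baseReach p q nq))))
                  (walk→reach (proj₁ (baseReach p q' nq')) (proj₂ (baseReach p q' nq')))
      where
      nq : q ≢ p
      nq eq = nu (cong (vtx C) eq)
      nq' : q' ≢ p
      nq' eq = nw (cong (vtx C) eq)

    isBlock : IsBlockGraph S (circSub S C)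
    isBlock = isSub , connected , λ { v ((p , refl) , nc) → nc (connected-minus p) }

  isSub-end : ∀ {Hs : Subgraph S} {e a b} → IsSub S Hs → se Hs e → Jn e a b → sv Hs b
  isSub-end {Hs} {e} is x (inj₁ eq) = subst (sv Hs) (cong proj₂ eq) (proj₂ (is e x))
  isSub-end {Hs} {e} is x (inj₂ eq) = subst (sv Hs) (cong proj₁ eq) (proj₁ (is e x))

  circle-maximal : (C : CircleΣ S) → (∀ e p → Incident S (vtx C p) e → ¬ InCE S C e → Isthmus S e) →
       ∀ H' → IsBlockGraph S H' → _⊆ₛ_ S (circSub S C) H' → _⊆ₛ_ S H' (circSub S C)
  circle-maximal C iso H' (isS , conn , nocut) (sv⊆ , se⊆) = vpart , epart
    where
    open Circ C
    kclaim : ∀ e p → se H' e → Incident S (vtx C p) e → InCE S C e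
    kclaim e p he inc with InCE? e
    ... | yes x = x
    ... | no nx = ⊥-elim (nocut (vtx C p) (sv⊆ _ (p , refl) , contra))
      where
      y = opposite e (vtx C p)
      jy : Jn e (vtx C p) y
      jy = joins-opposite inc
      contra : ¬ Connected S (delV S H' (vtx C p))
      contra cn = iso e p inc nx (proj₁ cyc') (proj₂ cyc')
        where
        yH : sv H' y
        yH = isSub-end {H'} isS he jy
        zH : sv H' (vtx C (cyc p))
        zH = sv⊆ _ (cyc p , refl)
        r1 = reach→walk (cn y (vtx C (cyc p)) (yH , (λ eq → joins-≢ lf jy (sym eq))) (zH , (λ eq → cyc≢id 1≤K p (vinj C _ _ eq))))
        w2 = walkC (cyc p) p
        cyc' = circleThrough jy (proj₁ r1 ++W proj₁ w2)
                 (all-++ (proj₁ r1) (proj₁ w2)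
                   (all-mono (λ e' x eq → proj₂ x (subst (Incident S (vtx C p)) (sym eq) inc)) (proj₁ r1) (proj₂ r1))
                   (all-mono (λ e' x eq → nx (subst (InCE S C) eq x)) (proj₁ w2) (proj₂ w2)))
    reachC : ∀ {u} → Reach S (se H') (vtx C zero) u → InCV S C u
    reachC here = zero , refl
    reachC (step e r ese j) with reachC r
    ... | q , refl = endC (kclaim e q ese (joins-incidentˡ j)) j
    vpart : ∀ v → sv H' v → InCV S C v
    vpart v hv = reachC (conn (vtx C zero) v (sv⊆ _ (zero , refl)) hv)
    epart : ∀ e → se H' e → InCE S C e
    epart e he with vpart _ (proj₁ (isS e he))
    ... | q , eq = kclaim e q he (inj₁ (sym eq))

-- Sufficiency of balance and (1)–(3)

module TameVertices (S : SGraph) (lf : Loopless S) where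
  open Walks S
  open SimpleWalks S lf
  open LineGraph S lf
  open CircleStructure S lf

  endCount≥1 : ∀ {v e} → Incident S v e → 1 ≤ endCount S v e
  endCount≥1 {v} {e} (inj₁ p) with proj₁ (en e) ≟F v
  ... | yes _ = s≤s z≤n
  ... | no np = ⊥-elim (np p)
  endCount≥1 {v} {e} (inj₂ p) with proj₁ (en e) ≟F v | proj₂ (en e) ≟F v
  ... | yes _ | _ = s≤s z≤n
  ... | no _ | yes _ = s≤s z≤n
  ... | no _ | no np = ⊥-elim (np p)

  deg≥3 : ∀ {v a b c} → Incident S v a → Incident S v b → Incident S v c → a ≢ b → b ≢ c → a ≢ c → 3 ≤ deg S v
  deg≥3 ia ib ic ab bc ac = sumF≥3 _ _ _ _ ab bc ac (endCount≥1 ia) (endCount≥1 ib) (endCount≥1 ic)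

  deg≤2-¬three : ∀ {v a b c} → deg S v ≤ 2 → Incident S v a → Incident S v b → Incident S v c → a ≢ b → b ≢ c → a ≢ c → ⊥
  deg≤2-¬three le ia ib ic ab bc ac = NP.<-irrefl refl (NP.≤-trans (deg≥3 ia ib ic ab bc ac) le)

  -- The local shape that conditions (1)–(3) give a vertex carrying a negative edge.
  record Tame (x : Vx) : Set where
    field
      negative-flanked : ∀ {a b c} → Incident S x a → Incident S x b → Incident S x c → a ≢ b → b ≢ c → a ≢ c → sg b ≡ ⊖ →
           (sg a ≡ ⊕ × Isthmus S a × sg c ≡ ⊖) ⊎ (sg c ≡ ⊕ × Isthmus S c × sg a ≡ ⊖)
      ¬four-edges : ∀ {a b c d} → Incident S x a → Incident S x b → Incident S x c → Incident S x d →
           a ≢ b → a ≢ c → a ≢ d → b ≢ c → b ≢ d → c ≢ d → ⊥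

  tame-deg≤2 : ∀ {x} → deg S x ≤ 2 → Tame x
  tame-deg≤2 le = record { negative-flanked = λ ia ib ic ab bc ac _ → ⊥-elim (deg≤2-¬three le ia ib ic ab bc ac)
                      ; ¬four-edges = λ ia ib ic id ab ac ad bc bd cd → deg≤2-¬three le ia ib ic ab bc ac }

  module Tameness (x : Vx) (X : Ed → Set) (X? : Decidable X) (Xneg : ∀ e → X e → sg e ≡ ⊖)
             (¬three-in-X : ∀ {a b c} → X a → X b → X c → Incident S x a → Incident S x b → Incident S x c → a ≢ b → b ≢ c → a ≢ c → ⊥)
             (others : AtMostOneOther S x X) where
    tame : Tame x
    tame = record { negative-flanked = negative-flanked' ; ¬four-edges = ¬four-edges' }
      where
      negative-flanked' : ∀ {a b c} → Incident S x a → Incident S x b → Incident S x c → a ≢ b → b ≢ c → a ≢ c → sg b ≡ ⊖ →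
           (sg a ≡ ⊕ × Isthmus S a × sg c ≡ ⊖) ⊎ (sg c ≡ ⊕ × Isthmus S c × sg a ≡ ⊖)
      negative-flanked' {a} {b} {c} ia ib ic ab bc ac nb with X? b
      ... | no nxb = ⊥-elim (⊖≢⊕ (trans (sym nb) (proj₁ (proj₂ others b ib nxb))))
      ... | yes xb with X? a | X? c
      ... | yes xa | yes xc = ⊥-elim (¬three-in-X xa xb xc ia ib ic ab bc ac)
      ... | no nxa | no nxc = ⊥-elim (ac (proj₁ others a c ia ic nxa nxc))
      ... | no nxa | yes xc = inj₁ (proj₁ (proj₂ others a ia nxa) , proj₂ (proj₂ others a ia nxa) , Xneg c xc)
      ... | yes xa | no nxc = inj₂ (proj₁ (proj₂ others c ic nxc) , proj₂ (proj₂ others c ic nxc) , Xneg a xa)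
      ¬four-edges' : ∀ {a b c d} → Incident S x a → Incident S x b → Incident S x c → Incident S x d →
           a ≢ b → a ≢ c → a ≢ d → b ≢ c → b ≢ d → c ≢ d → ⊥
      ¬four-edges' {a} {b} {c} {d} ia ib ic id ab ac ad bc bd cd with X? a | X? b | X? c | X? d
      ... | yes xa | yes xb | yes xc | _ = ¬three-in-X xa xb xc ia ib ic ab bc ac
      ... | yes xa | yes xb | no nxc | yes xd = ¬three-in-X xa xb xd ia ib id ab bd ad
      ... | yes xa | yes xb | no nxc | no nxd = cd (proj₁ others c d ic id nxc nxd)
      ... | yes xa | no nxb | yes xc | yes xd = ¬three-in-X xa xc xd ia ic id ac cd ad
      ... | yes xa | no nxb | yes xc | no nxd = bd (proj₁ others b d ib id nxb nxd)
      ... | yes xa | no nxb | no nxc | _ = bc (proj₁ others b c ib ic nxb nxc)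
      ... | no nxa | yes xb | yes xc | yes xd = ¬three-in-X xb xc xd ib ic id bc cd bd
      ... | no nxa | yes xb | yes xc | no nxd = ad (proj₁ others a d ia id nxa nxd)
      ... | no nxa | yes xb | no nxc | _ = ac (proj₁ others a c ia ic nxa nxc)
      ... | no nxa | no nxb | _ | _ = ab (proj₁ others a b ia ib nxa nxb)

  pigeonhole₂ : ∀ {A I : Set} {f : I → A} (P Q : I → Set) → (∀ i j → P i → P j → i ≡ j) → (∀ i j → Q i → Q j → i ≡ j) →
        ∀ {a b c} → P a ⊎ Q a → P b ⊎ Q b → P c ⊎ Q c → f a ≢ f b → f b ≢ f c → f a ≢ f c → ⊥
  pigeonhole₂ P Q uP uQ (inj₁ pa) (inj₁ pb) _ ab bc ac = ab (cong _ (uP _ _ pa pb))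
  pigeonhole₂ P Q uP uQ (inj₂ qa) (inj₂ qb) _ ab bc ac = ab (cong _ (uQ _ _ qa qb))
  pigeonhole₂ P Q uP uQ (inj₁ pa) (inj₂ qb) (inj₁ pc) ab bc ac = ac (cong _ (uP _ _ pa pc))
  pigeonhole₂ P Q uP uQ (inj₁ pa) (inj₂ qb) (inj₂ qc) ab bc ac = bc (cong _ (uQ _ _ qb qc))
  pigeonhole₂ P Q uP uQ (inj₂ qa) (inj₁ pb) (inj₁ pc) ab bc ac = bc (cong _ (uP _ _ pb pc))
  pigeonhole₂ P Q uP uQ (inj₂ qa) (inj₁ pb) (inj₂ qc) ab bc ac = ac (cong _ (uQ _ _ qa qc))

  tame-onCircle : (C : CircleΣ S) → NegCircleComp S C → (∀ i → AtMostOneOther S (vtx C i) (InCE S C)) → ∀ p → Tame (vtx C p)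
  tame-onCircle C ncc others p = Tameness.tame (vtx C p) (InCE S C) InCE? (λ { e (i , refl) → proj₁ ncc i }) ¬three-in-X (others p)
    where
    open Circ C
    ¬three-in-X : ∀ {a b c} → InCE S C a → InCE S C b → InCE S C c → Incident S (vtx C p) a → Incident S (vtx C p) b →
         Incident S (vtx C p) c → a ≢ b → b ≢ c → a ≢ c → ⊥
    ¬three-in-X (qa , refl) (qb , refl) (qc , refl) ia ib ic ab bc ac =
      pigeonhole₂ {f = edg C} (_≡ p) (_≡ prev p) (λ i j a b → trans a (sym b)) (λ i j a b → trans a (sym b))
          (incident-edges p qa ia) (incident-edges p qb ib) (incident-edges p qc ic) ab bc ac

  tame-onPath : (P : Path S) → (∀ q → Negative S (pedg P q)) → ∀ i → i ≢ zero → i ≢ fromℕ (suc (pk P)) →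
             AtMostOneOther S (pvtx P i) (InPE S P) → Tame (pvtx P i)
  tame-onPath P neg i nz nl others = Tameness.tame (pvtx P i) (InPE S P) (λ e → any? (λ q → pedg P q ≟F e))
       (λ { e (q , refl) → neg q }) ¬three-in-X others
    where
    cls : ∀ q → Incident S (pvtx P i) (pedg P q) → inject₁ q ≡ i ⊎ suc q ≡ i
    cls q inc with joins-incident (pjoins P q) inc
    ... | inj₁ x = inj₁ (sym (pvinj P _ _ x))
    ... | inj₂ y = inj₂ (sym (pvinj P _ _ y))
    ¬three-in-X : ∀ {a b c} → InPE S P a → InPE S P b → InPE S P c → Incident S (pvtx P i) a → Incident S (pvtx P i) b →
         Incident S (pvtx P i) c → a ≢ b → b ≢ c → a ≢ c → ⊥
    ¬three-in-X (qa , refl) (qb , refl) (qc , refl) ia ib ic ab bc ac =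
      pigeonhole₂ {f = pedg P} (λ q → inject₁ q ≡ i) (λ q → suc q ≡ i)
          (λ q q' a b → inject₁-injective (trans a (sym b))) (λ q q' a b → suc-injective (trans a (sym b)))
          (cls qa ia) (cls qb ib) (cls qc ic) ab bc ac

  tameAtNegative : Cond1 S → Cond2 S → Cond3 S → ∀ {x e} → Incident S x e → sg e ≡ ⊖ → Tame x
  tameAtNegative c1 c2 c3 {x} {e} inc ne with c1 x
  ... | inj₁ none = ⊥-elim (none e ne inc)
  ... | inj₂ (inj₁ (C , ncc , (p , refl))) = tame-onCircle C ncc (proj₂ (c2 C ncc)) p
  ... | inj₂ (inj₂ (P , npc , (i , refl))) with c3 P npc
  ... | _ , dS , dE , amooI , _ with i ≟F zero | i ≟F fromℕ (suc (pk P))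
  ... | yes refl | _ = tame-deg≤2 dS
  ... | no _ | yes refl = tame-deg≤2 dE
  ... | no nz | no nl = tame-onPath P (proj₁ npc) i nz nl (amooI i nz nl)

module Backward (S : SGraph) (lf : Loopless S) where
  open Walks S
  open SimpleWalks S lf
  open LineGraph S lf
  open CircleStructure S lf
  open TameVertices S lf

  lineEdge-unique : ∀ {a b} (l l' : LEdge S) → Joins (lends S) l a b → Joins (lends S) l' b a → commonVertex l ≡ commonVertex l' → l ≡ l'
  lineEdge-unique ((a1 , b1 , v1) , t1) ((a2 , b2 , v2) , t2) j1 j2 refl = go j1 j2
    where
    lt1 = NP.<ᵇ⇒< (toℕ a1) (toℕ b1) (proj₁ (Equivalence.to T-∧ t1))
    lt2 = NP.<ᵇ⇒< (toℕ a2) (toℕ b2) (proj₁ (Equivalence.to T-∧ t2))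
    fin : (a1 , b1) ≡ (a2 , b2) → ((a1 , b1 , v1) , t1) ≡ ((a2 , b2 , v1) , t2)
    fin refl = cong (λ t → ((a1 , b1 , v1) , t)) (T-irrelevant t1 t2)
    go : _ → _ → ((a1 , b1 , v1) , t1) ≡ ((a2 , b2 , v1) , t2)
    go (inj₁ x) (inj₁ y) = ⊥-elim (NP.<-asym (subst₂ (λ p q → toℕ p < toℕ q) (cong proj₁ x) (cong proj₂ x) lt1)
                                       (subst₂ (λ p q → toℕ p < toℕ q) (cong proj₁ y) (cong proj₂ y) lt2))
    go (inj₁ x) (inj₂ y) = fin (trans x (sym y))
    go (inj₂ x) (inj₁ y) = fin (trans x (sym y))
    go (inj₂ x) (inj₂ y) = ⊥-elim (NP.<-asym (subst₂ (λ p q → toℕ p < toℕ q) (cong proj₁ x) (cong proj₂ x) lt1)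
                                       (subst₂ (λ p q → toℕ p < toℕ q) (cong proj₁ y) (cong proj₂ y) lt2))

  module LineCircle (Z : CircleL S) where
    K = k Z
    x = vtx Z
    l = edg Z

    w : Fin (suc K) → Vx
    w i = commonVertex (l i)

    w-incident : ∀ i → Incident S (w i) (x i) × Incident S (w i) (x (cyc i))
    w-incident i with lineEdge-props (l i) | joins Z i
    ... | ia , ib , _ | inj₁ eq = subst (Incident S (w i)) (cong proj₁ eq) ia , subst (Incident S (w i)) (cong proj₂ eq) ib
    ... | ia , ib , _ | inj₂ eq = subst (Incident S (w i)) (cong proj₂ eq) ib , subst (Incident S (w i)) (cong proj₁ eq) ia

    1≤K : 1 ≤ K
    1≤K = circle-1≤k {ends = lends S} (λ l' → proj₂ (proj₂ (lineEdge-props l'))) Z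

    x-injective : ∀ a b → a ≢ b → x a ≢ x b
    x-injective a b ne eq = ne (vinj Z _ _ eq)

    -- The edges x i of Γ along Z are traversed from w i to w (cyc i): a single edge, or nothing
    -- when consecutive L-edges share their vertex (a pivot, whose sign is then not accounted for).
    record Step (i : Fin (suc K)) : Set where
      field
        walk       : Walk (w i) (w (cyc i))
        pivotSign  : Sign
        sign-split : sg (x (cyc i)) ≡ signW walk · pivotSign
        along      : AllE (_≡ x (cyc i)) walk
        pivot      : pivotSign ≡ ⊖ → (w i ≡ w (cyc i)) × sg (x (cyc i)) ≡ ⊖
    open Step

    stepAt : ∀ i → Step i
    stepAt i with w i ≟F w (cyc i)
    ... | yes eq = record { walk = castW refl eq wnil ; pivotSign = sg (x (cyc i))
                          ; sign-split = cong (_· sg (x (cyc i))) (sym (signW-cast refl eq wnil))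
                          ; along = all-cast refl eq wnil [] ; pivot = λ t → eq , t }
    ... | no ne = record { walk = single (incident⇒joins (proj₂ (w-incident i)) (proj₁ (w-incident (cyc i))) ne)
                         ; pivotSign = ⊕ ; sign-split = sym (trans (·-⊕ʳ _) (·-⊕ʳ _))
                         ; along = refl ∷ [] ; pivot = λ () }

    open Chain w (λ i → walk (stepAt i))

    sign-without-pivots : (∀ i → pivotSign (stepAt i) ≢ ⊖) → Balanced S → prod (λ i → sg (x i)) ≡ ⊕
    sign-without-pivots none bal = begin
      prod (λ i → sg (x i))                                         ≡⟨ prod-cyc (λ i → sg (x i)) ⟨
      prod (λ i → sg (x (cyc i)))                                   ≡⟨ prod-cong (λ i → sign-split (stepAt i)) ⟩
      prod (λ i → signW (walk (stepAt i)) · pivotSign (stepAt i))    ≡⟨ prod-mul (λ i → signW (walk (stepAt i))) (λ i → pivotSign (stepAt i)) ⟩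
      prod (λ i → signW (walk (stepAt i))) · prod (λ i → pivotSign (stepAt i))
        ≡⟨ cong₂ _·_ (trans (sym closed-sgn) (closedWalk-positive bal _ closedW NP.≤-refl))
                     (prod-⊕ _ (λ i → ≢⊖⇒≡⊕ (none i))) ⟩
      ⊕ ∎
      where open ≡-Reasoning

    -- The other steps close up into a walk around Z avoiding the edge x (cyc q).
    crossing-not-isthmus : ∀ q → w q ≢ w (cyc q) → ¬ Isthmus S (x (cyc q))
    crossing-not-isthmus q ne iso = iso (proj₁ cl) (proj₂ cl)
      where
      predc : ∀ a → cycN K (cyc a) ≡ a
      predc a = trans (cycN-comm K a) (cycN-full a)
      cl = circleThrough (incident⇒joins (proj₂ (w-incident q)) (proj₁ (w-incident (cyc q))) ne) (arcW q)
             (arc-all q (λ s a b → all-mono (λ e eq eq' → cycN≢id s q a b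
                (trans (sym (predc (cycN s q))) (trans (cong (cycN K) (vinj Z _ _ (trans (sym eq) eq'))) (predc q))))
                (walk (stepAt (cycN s q))) (along (stepAt (cycN s q)))))

    module Pivot (tame : ∀ {v e} → Incident S v e → sg e ≡ ⊖ → Tame v)
                 (i : Fin (suc K)) (isPivot : pivotSign (stepAt i) ≡ ⊖) where
      v = w i
      w-cyc : v ≡ w (cyc i)
      w-cyc = proj₁ (pivot (stepAt i) isPivot)
      middle-negative : sg (x (cyc i)) ≡ ⊖
      middle-negative = proj₂ (pivot (stepAt i) isPivot)
      ia : Incident S v (x i)
      ia = proj₁ (w-incident i)
      ib : Incident S v (x (cyc i))
      ib = proj₂ (w-incident i)
      ic : Incident S v (x (cyc (cyc i)))
      ic = subst (λ z → Incident S z (x (cyc (cyc i)))) (sym w-cyc) (proj₂ (w-incident (cyc i)))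
      ab : x i ≢ x (cyc i)
      ab = x-injective _ _ (λ e → cyc≢id 1≤K i (sym e))
      bc : x (cyc i) ≢ x (cyc (cyc i))
      bc = x-injective _ _ (λ e → cyc≢id 1≤K (cyc i) (sym e))
      open Tame (tame ib middle-negative)

      not-digon : K ≢ 1
      not-digon k1 = cyc≢id 1≤K i (sym (einj Z _ _ (lineEdge-unique (l i) (l (cyc i)) (joins Z i)
                       (subst (λ z → Joins (lends S) (l (cyc i)) (x (cyc i)) (x z)) (cyc²≡id k1 i) (joins Z (cyc i)))
                       w-cyc)))

      triangle : (k2 : K ≡ 2) → prod (λ i → sg (x i)) ≡ ⊕
      triangle k2 = trans (prod-triangle k2 (λ i → sg (x i)) i) (fin (negative-flanked ia ib ic ab bc ac middle-negative))
        where
        ac : x i ≢ x (cyc (cyc i))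
        ac = x-injective _ _ (λ e → cyc²≢id (NP.≤-reflexive (sym k2)) i (sym e))
        fin : _ → sg (x i) · (sg (x (cyc i)) · sg (x (cyc (cyc i)))) ≡ ⊕
        fin (inj₁ (a , _ , c)) = trans (cong₂ (λ p q → p · (sg (x (cyc i)) · q)) a c) (cong (λ z → ⊕ · (z · ⊖)) middle-negative)
        fin (inj₂ (c , _ , a)) = trans (cong₂ (λ p q → p · (sg (x (cyc i)) · q)) a c) (cong (λ z → ⊖ · (z · ⊕)) middle-negative)

      -- On a longer circle the positive isthmus among x i, x (cyc² i) cannot be crossed by a step,
      -- so its far end is v again and v would carry four edges of Z.
      not-long : 3 ≤ K → ⊥
      not-long K3 = fin3 (negative-flanked ia ib ic ab bc ac middle-negative)
        where
        ac : x i ≢ x (cyc (cyc i))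
        ac = x-injective _ _ (λ e → cyc²≢id (NP.≤-trans (s≤s (s≤s z≤n)) K3) i (sym e))
        d : ∀ a b → a ≤ K → b ≤ K → a ≢ b → x (cycN a i) ≢ x (cycN b i)
        d a b ak bk ne = x-injective _ _ (cycN-≢ a b i ak bk ne)
        Kne : ∀ a → a < 3 → K ≢ a
        Kne a lt e = NP.<-irrefl refl (NP.<-≤-trans lt (subst (3 ≤_) e K3))
        k1' = NP.≤-trans (s≤s z≤n) K3
        k2' = NP.≤-trans (s≤s (s≤s z≤n)) K3
        fin3 : _ → ⊥
        fin3 (inj₁ (_ , iso , _)) with w (cycN K i) ≟F w (cyc (cycN K i))
        ... | no ne = crossing-not-isthmus (cycN K i) ne (subst (Isthmus S) (cong x (sym (cycN-full i))) iso)
        ... | yes eq = ¬four-edges id ia ib ic (d K 0 NP.≤-refl z≤n (Kne 0 (s≤s z≤n))) (d K 1 NP.≤-refl k1' (Kne 1 (s≤s (s≤s z≤n))))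
                 (d K 2 NP.≤-refl k2' (Kne 2 NP.≤-refl)) ab ac bc
          where
          id : Incident S v (x (cycN K i))
          id = subst (λ z → Incident S z (x (cycN K i))) (trans eq (cong w (cycN-full i))) (proj₁ (w-incident (cycN K i)))
        fin3 (inj₂ (_ , iso , _)) with w (cyc i) ≟F w (cyc (cyc i))
        ... | no ne = crossing-not-isthmus (cyc i) ne iso
        ... | yes eq = ¬four-edges ia ib ic id ab ac (d 0 3 z≤n K3 (λ ())) bc (d 1 3 k1' K3 (λ ())) (d 2 3 k2' K3 (λ ()))
          where
          id : Incident S v (x (cycN 3 i))
          id = subst (λ z → Incident S z (x (cycN 3 i))) (trans (sym eq) (sym w-cyc)) (proj₂ (w-incident (cyc (cyc i))))

      sign : prod (λ i → sg (x i)) ≡ ⊕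
      sign with K ℕ.≟ 1 | K ℕ.≟ 2
      ... | yes k1 | _ = ⊥-elim (not-digon k1)
      ... | no _ | yes k2 = triangle k2
      ... | no nk1 | no nk2 = ⊥-elim (not-long (NP.≤∧≢⇒< (NP.≤∧≢⇒< 1≤K (λ e → nk1 (sym e))) (λ e → nk2 (sym e))))

    sign : Balanced S → (∀ {v e} → Incident S v e → sg e ≡ ⊖ → Tame v) → prod (λ i → sg (x i)) ≡ ⊕
    sign bal tame with any? (λ i → pivotSign (stepAt i) ≟ˢ ⊖)
    ... | no none = sign-without-pivots (λ i p → none (i , p)) bal
    ... | yes (i , p) = Pivot.sign tame i p

  conditions⇒lineConsistent : Balanced S → Cond1 S → Cond2 S → Cond3 S → LineConsistent S
  conditions⇒lineConsistent bal c1 c2 c3 Z = LineCircle.sign Z bal (tameAtNegative c1 c2 c3)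

module Blocks (S : SGraph) (lf : Loopless S) where
  open Walks S
  open SimpleWalks S lf
  open LineGraph S lf
  open CircleStructure S lf

  BoundedWalk : (Ed → Set) → ℕ → Vx → Vx → Set
  BoundedWalk P N u w = Σ (Walk u w) λ p → AllE P p × len p ≤ N

  boundedWalk? : ∀ {P : Ed → Set} → Decidable P → ∀ N u w → Dec (BoundedWalk P N u w)
  boundedWalk? P? zero u w with u ≟F w
  ... | yes refl = yes (wnil , [] , z≤n)
  ... | no ne = no λ { (wnil , _ , _) → ne refl ; (wcons _ _ _ , _ , ()) }
  boundedWalk? {P} P? (suc N) u w with u ≟F w
  ... | yes refl = yes (wnil , [] , z≤n)
  ... | no ne with any? (λ e → P? e ×-dec (incident? u e ×-dec boundedWalk? P? N (opposite e u) w))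
  ... | yes (e , pe , inc , p , a , le) = yes (wcons e (joins-opposite inc) p , pe ∷ a , s≤s le)
  ... | no nq = no λ { (wnil , _ , _) → ne refl
                     ; (wcons e j p , pe ∷ a , s≤s le) → nq (e , pe , joins-incidentˡ j ,
                          subst (λ z → BoundedWalk P N z w) (sym (joins-functional lf (joins-opposite (joins-incidentˡ j)) j)) (p , a , le)) }

  walk? : ∀ {P : Ed → Set} → Decidable P → ∀ u w → Dec (Σ (Walk u w) (AllE P))
  walk? P? u w with boundedWalk? P? (n S) u w
  ... | yes (p , a , _) = yes (p , a)
  ... | no nr = no λ { (p , a) → let (q , d , aq) = shortcut p a in nr (q , aq , NP.<⇒≤ (simple-length<n q d)) }

  reach? : ∀ {P : Ed → Set} → Decidable P → ∀ u w → Dec (Reach S P u w)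
  reach? P? u w with walk? P? u w
  ... | yes (p , a) = yes (walk→reach p a)
  ... | no np = no λ r → np (reach→walk r)

  connected? : (Hs : Subgraph S) → (∀ v → Dec (sv Hs v)) → (∀ e → Dec (se Hs e)) → Dec (Connected S Hs)
  connected? Hs dv de with all? (λ u → all? (λ w → dv u →-dec (dv w →-dec reach? de u w)))
  ... | yes f = yes (λ u w a b → f u w a b)
  ... | no nf = no (λ c → nf (λ u w a b → c u w a b))

  SameSub : Subgraph S → Subgraph S → Set
  SameSub H1 H2 = (∀ v → sv H1 v → sv H2 v) × (∀ v → sv H2 v → sv H1 v) × (∀ e → se H1 e → se H2 e) × (∀ e → se H2 e → se H1 e)

  connected-resp : ∀ {H1 H2} → SameSub H1 H2 → Connected S H1 → Connected S H2
  connected-resp (v12 , v21 , e12 , e21) c u w a b = reach-mono e12 (c u w (v21 u a) (v21 w b))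

  delV-resp : ∀ {H1 H2} x → SameSub H1 H2 → SameSub (delV S H1 x) (delV S H2 x)
  delV-resp x (v12 , v21 , e12 , e21) = (λ v p → v12 v (proj₁ p) , proj₂ p) , (λ v p → v21 v (proj₁ p) , proj₂ p) ,
                                   (λ e p → e12 e (proj₁ p) , proj₂ p) , (λ e p → e21 e (proj₁ p) , proj₂ p)

  isBlock-resp : ∀ {H1 H2} → SameSub H1 H2 → IsBlockGraph S H1 → IsBlockGraph S H2
  isBlock-resp {H1} {H2} eq@(v12 , v21 , e12 , e21) (is , c , nc) =
    (λ e x → let (a , b) = is e (e21 e x) in v12 _ a , v12 _ b) , connected-resp eq c ,
    (λ v → λ { (xv , ncon) → nc v (v21 v xv , (λ c1 → ncon (connected-resp (delV-resp v eq) c1))) })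

  BoolSub : Set
  BoolSub = (Fin (n S) → Bool) × (Fin (m S) → Bool)

  toSub : BoolSub → Subgraph S
  toSub Hb = record { sv = λ v → T (proj₁ Hb v) ; se = λ e → T (proj₂ Hb e) }

  isSub? : (Hs : Subgraph S) → (∀ v → Dec (sv Hs v)) → (∀ e → Dec (se Hs e)) → Dec (IsSub S Hs)
  isSub? Hs dv de with all? (λ e → de e →-dec (dv (proj₁ (en e)) ×-dec dv (proj₂ (en e))))
  ... | yes f = yes (λ e x → f e x)
  ... | no nf = no (λ f → nf (λ e x → f e x))

  isBlock? : (Hs : Subgraph S) → (∀ v → Dec (sv Hs v)) → (∀ e → Dec (se Hs e)) → Dec (IsBlockGraph S Hs)
  isBlock? Hs dv de = isSub? Hs dv de ×-dec connected? Hs dv de ×-dec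
     map′ (λ f v → f v) (λ f v → f v)
       (all? (λ v → ¬? (dv v ×-dec ¬? (connected? (delV S Hs v) (λ u → dv u ×-dec ¬? (u ≟F v))
                                                       (λ e → de e ×-dec ¬? (incident? v e))))))

  SameBool : BoolSub → BoolSub → Set
  SameBool (a , b) (c , d) = (∀ i → a i ≡ c i) × (∀ i → b i ≡ d i)

  SameBool⇒SameSub : ∀ {H1 H2} → SameBool H1 H2 → SameSub (toSub H1) (toSub H2)
  SameBool⇒SameSub (ev , ee) = (λ v t → subst T (ev v) t) , (λ v t → subst T (sym (ev v)) t) ,
                        (λ e t → subst T (ee e) t) , (λ e t → subst T (sym (ee e)) t)

  ∃-boolSub? : (Q : BoolSub → Set) → (∀ H1 H2 → SameBool H1 H2 → Q H1 → Q H2) → (∀ Hb → Dec (Q Hb)) → Dec (Σ BoolSub Q)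
  ∃-boolSub? Q resp dq with ∃-boolFun? (n S) (λ hv → Σ (Fin (m S) → Bool) λ he → Q (hv , he))
        (λ f g e (he , q) → he , resp _ _ (e , λ _ → refl) q)
        (λ hv → ∃-boolFun? (m S) (λ he → Q (hv , he)) (λ f g e q → resp _ _ ((λ _ → refl) , e) q) (λ he → dq _))
  ... | yes (hv , he , q) = yes ((hv , he) , q)
  ... | no nq = no λ { ((hv , he) , q) → nq (hv , he , q) }

  toBoolSub : (Hs : Subgraph S) → (∀ v → Dec (sv Hs v)) → (∀ e → Dec (se Hs e)) → BoolSub
  toBoolSub Hs dv de = (λ v → ⌊ dv v ⌋) , (λ e → ⌊ de e ⌋)

  toBoolSub-same : (Hs : Subgraph S) (dv : ∀ v → Dec (sv Hs v)) (de : ∀ e → Dec (se Hs e)) → SameSub Hs (toSub (toBoolSub Hs dv de))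
  toBoolSub-same Hs dv de = (λ v x → fromWitness x) , (λ v t → toWitness t) , (λ e x → fromWitness x) , (λ e t → toWitness t)

  -- The block containing f0 is the union of all block subgraphs through f0.  Quantifying over
  -- them is decidable because subgraphs are enumerated as pairs of Boolean vectors.
  module UnionOfBlocks (f0 : Ed) where
    Candidate : BoolSub → Set
    Candidate Hb = IsBlockGraph S (toSub Hb) × T (proj₂ Hb f0)

    candidate-resp : ∀ H1 H2 → SameBool H1 H2 → Candidate H1 → Candidate H2
    candidate-resp H1 H2 eq (b , t) = isBlock-resp (SameBool⇒SameSub eq) b , subst T (proj₂ eq f0) t

    candidate? : ∀ Hb → Dec (Candidate Hb)
    candidate? Hb = isBlock? (toSub Hb) (λ v → T? _) (λ e → T? _) ×-dec T? _

    Union : Subgraph S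
    Union = record { sv = λ v → Σ BoolSub λ Hb → Candidate Hb × T (proj₁ Hb v)
                ; se = λ e → Σ BoolSub λ Hb → Candidate Hb × T (proj₂ Hb e) }

    inUnionᵛ? : ∀ v → Dec (sv Union v)
    inUnionᵛ? v = ∃-boolSub? _ (λ H1 H2 eq (c , t) → candidate-resp H1 H2 eq c , subst T (proj₁ eq v) t) (λ Hb → candidate? Hb ×-dec T? _)

    inUnionᵉ? : ∀ e → Dec (se Union e)
    inUnionᵉ? e = ∃-boolSub? _ (λ H1 H2 eq (c , t) → candidate-resp H1 H2 eq c , subst T (proj₂ eq e) t) (λ Hb → candidate? Hb ×-dec T? _)

    a0 = proj₁ (en f0)
    b0 = proj₂ (en f0)

    f0-ends : ∀ Hb → Candidate Hb → T (proj₁ Hb a0) × T (proj₁ Hb b0)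
    f0-ends Hb ((is , _ , _) , t) = is f0 t

    lift-reach : ∀ Hb → Candidate Hb → ∀ {u w} → Reach S (λ e → T (proj₂ Hb e)) u w → Reach S (se Union) u w
    lift-reach Hb c = reach-mono (λ e t → Hb , c , t)

    union-isSub : IsSub S Union
    union-isSub e (Hb , c , t) = let (a , b) = proj₁ (proj₁ c) e t in (Hb , c , a) , (Hb , c , b)

    union-connected : Connected S Union
    union-connected u w (H1 , c1 , t1) (H2 , c2 , t2) =
      reach-trans (lift-reach H1 c1 (proj₁ (proj₂ (proj₁ c1)) u a0 t1 (proj₁ (f0-ends H1 c1))))
                  (lift-reach H2 c2 (proj₁ (proj₂ (proj₁ c2)) a0 w (proj₁ (f0-ends H2 c2)) t2))

    union-minus-reach : ∀ Hb → Candidate Hb → ∀ x u c → T (proj₁ Hb u) → u ≢ x → T (proj₁ Hb c) → c ≢ x →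
               Reach S (se (delV S Union x)) u c
    union-minus-reach Hb cd x u c tu ux tc cx with T? (proj₁ Hb x)
    ... | yes tx = reach-mono (λ e p → (Hb , cd , proj₁ p) , proj₂ p) (conn' u c (tu , ux) (tc , cx))
      where
      dv : ∀ v → Dec (sv (delV S (toSub Hb) x) v)
      dv v = T? _ ×-dec ¬? (v ≟F x)
      de : ∀ e → Dec (se (delV S (toSub Hb) x) e)
      de e = T? _ ×-dec ¬? (incident? x e)
      conn' : Connected S (delV S (toSub Hb) x)
      conn' = decidable-stable (connected? _ dv de) (λ nc → proj₂ (proj₂ (proj₁ cd)) x (tx , nc))
    ... | no nx = reach-mono (λ e t → (Hb , cd , t) , noinc e t) (proj₁ (proj₂ (proj₁ cd)) u c tu tc)
      where
      noinc : ∀ e → T (proj₂ Hb e) → ¬ Incident S x e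
      noinc e t (inj₁ p) = nx (subst (λ z → T (proj₁ Hb z)) p (proj₁ (proj₁ (proj₁ cd) e t)))
      noinc e t (inj₂ p) = nx (subst (λ z → T (proj₁ Hb z)) p (proj₂ (proj₁ (proj₁ cd) e t)))

    union-minus-connected : ∀ x → Connected S (delV S Union x)
    union-minus-connected x u w ((H1 , c1 , t1) , ux) ((H2 , c2 , t2) , wx) with a0 ≟F x
    ... | no a0x = reach-trans (union-minus-reach H1 c1 x u a0 t1 ux (proj₁ (f0-ends H1 c1)) a0x)
                               (reach-sym (union-minus-reach H2 c2 x w a0 t2 wx (proj₁ (f0-ends H2 c2)) a0x))
    ... | yes refl = reach-trans (union-minus-reach H1 c1 x u b0 t1 ux (proj₂ (f0-ends H1 c1)) b0x)
                               (reach-sym (union-minus-reach H2 c2 x w b0 t2 wx (proj₂ (f0-ends H2 c2)) b0x))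
      where
      b0x : b0 ≢ a0
      b0x e = lf f0 (sym e)

    union-isBlock : IsBlockGraph S Union
    union-isBlock = union-isSub , union-connected , λ v → λ { (_ , nc) → nc (union-minus-connected v) }

    union-maximal : ∀ H0 → Candidate H0 → ∀ H' → IsBlockGraph S H' → _⊆ₛ_ S Union H' → _⊆ₛ_ S H' Union
    union-maximal H0 c0 H' bH' (v⊆ , e⊆) = (λ v x → decidable-stable (inUnionᵛ? v) (λ nv → fin (λ c → nv (proj₁ c v x))))
                                  , (λ e x → decidable-stable (inUnionᵉ? e) (λ ne → fin (λ c → ne (proj₂ c e x))))
      where
      fin : ¬ ((∀ v → sv H' v → sv Union v) × (∀ e → se H' e → se Union e)) → ⊥
      fin k = ¬¬-decidable-Fin (n S) (sv H') (λ dv → ¬¬-decidable-Fin (m S) (se H') (λ de → k (build dv de)))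
        where
        build : (dv : ∀ v → Dec (sv H' v)) (de : ∀ e → Dec (se H' e)) → (∀ v → sv H' v → sv Union v) × (∀ e → se H' e → se Union e)
        build dv de = (λ v x → Hb , cand , fromWitness x) , (λ e x → Hb , cand , fromWitness x)
          where
          Hb = toBoolSub H' dv de
          cand : Candidate Hb
          cand = isBlock-resp (toBoolSub-same H' dv de) bH' , fromWitness (e⊆ f0 (H0 , c0 , proj₂ c0))

  blockContaining : (f0 : Ed) (Hs : Subgraph S) → (∀ v → Dec (sv Hs v)) → (∀ e → Dec (se Hs e)) →
                IsBlockGraph S Hs → se Hs f0 → Σ (Subgraph S) λ B → BlockOf S B × _⊆ₛ_ S Hs B
  blockContaining f0 Hs dv de bH h0 = Union , (union-isBlock , union-maximal H0 c0) ,
        ((λ v x → H0 , c0 , fromWitness x) , (λ e x → H0 , c0 , fromWitness x))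
    where
    open UnionOfBlocks f0
    H0 = toBoolSub Hs dv de
    c0 : Candidate H0
    c0 = isBlock-resp (toBoolSub-same Hs dv de) bH , fromWitness h0

-- Necessity of balance and (1)–(3)

module ForwardLocal (S : SGraph) (lf : Loopless S) (lc : LineConsistent S) where
  open Walks S
  open SimpleWalks S lf
  open LineGraph S lf
  open CircleStructure S lf
  open TameVertices S lf
  open Blocks S lf
  open import Data.List.Membership.DecPropositional (_≟F_ {m S}) using () renaming (_∈?_ to _∈E?_)

  bal : Balanced S
  bal = lineConsistent⇒balanced lc

  lastEdge-unique : ∀ {y x} (Q : Walk y x) → Distinct (vertices Q) → ∀ {e1 e2} → e1 ∈ edges Q → e2 ∈ edges Q →
            Incident S x e1 → Incident S x e2 → e1 ≡ e2
  lastEdge-unique (wcons e j wnil) d (here refl) (here refl) _ _ = refl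
  lastEdge-unique {y} {x} (wcons e j (wcons e' j' Q'')) (dcons ny (dcons nv d)) m1 m2 i1 i2 = go m1 m2
    where
    noInc : ¬ Incident S x e
    noInc inc with joins-incident j inc
    ... | inj₁ refl = ny (there (end∈ Q''))
    ... | inj₂ refl = nv (end∈ Q'')
    go : _ → _ → _
    go (here refl) _ = ⊥-elim (noInc i1)
    go (there _) (here refl) = ⊥-elim (noInc i2)
    go (there a) (there b) = lastEdge-unique (wcons e' j' Q'') (dcons nv d) a b i1 i2

  around-circle : ∀ {e x} → Incident S x e → (Z : CircleΣ S) → InCE S Z e →
               Σ (Walk (opposite e x) x) (AllE (_≢ e))
  around-circle {e} {x} ie Z iz with Circ.onC→walk Z iz
  ... | a , b , jab , p , al with joins-incident jab ie
  ... | inj₁ refl = castW (joins-functional lf jab (joins-opposite ie)) refl p , all-cast _ refl p al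
  ... | inj₂ refl = castW (joins-functional lf (joins-sym jab) (joins-opposite ie)) refl (reverseW p) , all-cast _ refl (reverseW p) (all-rev p al)

  -- A circle through e misses one of a1, a2 at x; inserting that negative edge at x into the L-circle that
  -- follows the (positive) circle gives an L-circle of negative sign.
  isthmus-beside-negatives : ∀ {x e a1 a2} → Incident S x e → Incident S x a1 → Incident S x a2 → a1 ≢ a2 → a1 ≢ e → a2 ≢ e →
              sg a1 ≡ ⊖ → sg a2 ≡ ⊖ → Isthmus S e
  isthmus-beside-negatives {x} {e} {a1} {a2} ie i1 i2 a12 a1e a2e n1 n2 Z iz with around-circle ie Z iz
  ... | p , al with shortcut p al
  ... | Q , d , aq = choose (a1 ∈E? edges Q)
    where
    j = joins-opposite ie
    nf : e ∉ edges Q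
    nf = All≢⇒∉ aq
    sgQ : signW (wcons e j Q) ≡ ⊕
    sgQ = trans (sym (closeUp-sign j Q d nf)) (bal (closeUp j Q d nf))
    fin : ∀ {b'} → b' ≢ e → b' ∉ edges Q → Incident S x b' → sg b' ≡ ⊖ → ⊥
    fin bf bQ ib nb = ⊖≢⊕ (trans (sym nb) (trans (sym (trans (cong (sg _ ·_) sgQ) (·-⊕ʳ _)))
                                                    (insertion-positive lc j Q d nf bf bQ ib)))
    choose : Dec (a1 ∈ edges Q) → ⊥
    choose (yes m1) = fin a2e (λ m2 → a12 (lastEdge-unique Q d m1 m2 i1 i2)) i2 n2
    choose (no nm) = fin a1e nm i1 n1

  endCount≤1 : ∀ v e → endCount S v e ≤ 1
  endCount≤1 v e with proj₁ (en e) ≟F v | proj₂ (en e) ≟F v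
  ... | yes p | yes q = ⊥-elim (lf e (trans p (sym q)))
  ... | yes p | no _ = s≤s z≤n
  ... | no _ | yes _ = s≤s z≤n
  ... | no _ | no _ = z≤n

  endCount⇒incident : ∀ v e → 1 ≤ endCount S v e → Incident S v e
  endCount⇒incident v e h with proj₁ (en e) ≟F v | proj₂ (en e) ≟F v
  ... | yes p | _ = inj₁ p
  ... | no _ | yes q = inj₂ q
  ... | no _ | no _ = ⊥-elim (NP.<-irrefl refl h)

  three-incident : ∀ v → ¬ (deg S v ≤ 2) → Σ Ed λ a → Σ Ed λ b → Σ Ed λ c → a ≢ b × b ≢ c × a ≢ c ×
             Incident S v a × Incident S v b × Incident S v c
  three-incident v nd with support₃ (λ e → endCount S v e) (endCount≤1 v) (NP.≰⇒> nd)
  ... | a , b , c , ab , bc , ac , qa , qb , qc = a , b , c , ab , bc , ac , endCount⇒incident v a qa , endCount⇒incident v b qb , endCount⇒incident v c qc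

  lone-negative-¬two : ∀ {s e0} → Incident S s e0 → sg e0 ≡ ⊖ → (∀ e → Incident S s e → sg e ≡ ⊖ → e ≡ e0) →
               ∀ f g → f ≢ e0 → g ≢ e0 → f ≢ g → Incident S s f → Incident S s g → ⊥
  lone-negative-¬two {s} {e0} i0 n0 uniq f g f0 g0 fg if ig =
    ·-negative³ n0 (pos f if f0) (pos g ig g0) refl (star-positive lc i0 if ig (λ e → f0 (sym e)) fg (λ e → g0 (sym e)))
    where
    pos : ∀ h → Incident S s h → h ≢ e0 → sg h ≡ ⊕
    pos h ih h0 = ≢⊖⇒≡⊕ (λ nh → h0 (uniq h ih nh))

  lone-negative⇒deg≤2 : ∀ {s e0} → Incident S s e0 → sg e0 ≡ ⊖ → (∀ e → Incident S s e → sg e ≡ ⊖ → e ≡ e0) → deg S s ≤ 2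
  lone-negative⇒deg≤2 {s} {e0} i0 n0 uniq with deg S s ℕ.≤? 2
  ... | yes p = p
  ... | no np with three-incident s np
  ... | a , b , c , ab , bc , ac , ia , ib , ic with a ≟F e0 | b ≟F e0
  ... | yes refl | _ = ⊥-elim (lone-negative-¬two i0 n0 uniq b c (λ e → ab (sym e)) (λ e → ac (sym e)) bc ib ic)
  ... | no a0 | yes refl = ⊥-elim (lone-negative-¬two i0 n0 uniq a c a0 (λ e → bc (sym e)) ac ia ic)
  ... | no a0 | no b0 = ⊥-elim (lone-negative-¬two i0 n0 uniq a b a0 b0 ab ia ib)

  atMostOneOther-beside-negatives : ∀ {v a₁ a₂} (X : Ed → Set) → (∀ e → Incident S v e → Negative S e → X e) →
    X a₁ → X a₂ → Incident S v a₁ → Incident S v a₂ → a₁ ≢ a₂ → Negative S a₁ → Negative S a₂ → AtMostOneOther S v X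
  atMostOneOther-beside-negatives {v} {a₁} {a₂} X closed x₁ x₂ i₁ i₂ a₁₂ n₁ n₂ = unique , positive-isthmus
    where
    positive : ∀ e → Incident S v e → ¬ X e → sg e ≡ ⊕
    positive e ie ∉X = ≢⊖⇒≡⊕ (λ ne → ∉X (closed e ie ne))
    unique : ∀ e f → Incident S v e → Incident S v f → ¬ X e → ¬ X f → e ≡ f
    unique e f ie if ∉Xe ∉Xf with e ≟F f
    ... | yes eq = eq
    ... | no ne = ⊥-elim (·-negative³ (positive e ie ∉Xe) (positive f if ∉Xf) n₁ refl
                    (star-positive lc ie if i₁ ne (λ eq → ∉Xf (subst X (sym eq) x₁)) (λ eq → ∉Xe (subst X (sym eq) x₁))))
    positive-isthmus : ∀ e → Incident S v e → ¬ X e → (sg e ≡ ⊕) × Isthmus S e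
    positive-isthmus e ie ∉X = positive e ie ∉X , isthmus-beside-negatives ie i₁ i₂ a₁₂
      (λ eq → ∉X (subst X eq x₁)) (λ eq → ∉X (subst X eq x₂)) n₁ n₂

  ¬three-negative : ∀ {v a b c} → Incident S v a → Incident S v b → Incident S v c → a ≢ b → b ≢ c → a ≢ c →
                    Negative S a → Negative S b → Negative S c → ⊥
  ¬three-negative ia ib ic ab bc ac na nb nc = ·-negative³ na nb nc refl (star-positive lc ia ib ic ab bc ac)

module CircleComponents (S : SGraph) (lf : Loopless S) (lc : LineConsistent S) where
  open Walks S
  open SimpleWalks S lf
  open LineGraph S lf
  open CircleStructure S lf
  open TameVertices S lf
  open Blocks S lf
  open ForwardLocal S lf lc

  cond2 : Cond2 S
  cond2 C ncc = (isBlock , circle-maximal C (λ e p ie ∉C → proj₂ (proj₂ (atMostOneOther-onCircle p) e ie ∉C))) ,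
                atMostOneOther-onCircle
    where
    open Circ C
    atMostOneOther-onCircle : ∀ p → AtMostOneOther S (vtx C p) (InCE S C)
    atMostOneOther-onCircle p = atMostOneOther-beside-negatives (InCE S C)
      (λ e ie ne → proj₂ ncc (vtx C p) e (p , refl) ne ie) (p , refl) (prev p , refl)
      (incident-edge p) (incident-prevEdge p) (edge≢prevEdge p) (proj₁ ncc p) (proj₁ ncc (prev p))

  circle-other-edge : (Z : CircleΣ S) → ∀ {h v} → InCE S Z h → Incident S v h → Σ Ed λ h' → InCE S Z h' × Incident S v h' × h' ≢ h
  circle-other-edge Z (p , refl) inc with joins-incident (joins Z p) inc
  ... | inj₁ refl = edg Z (Circ.prev Z p) , (Circ.prev Z p , refl) , Circ.incident-prevEdge Z p , (λ e → Circ.edge≢prevEdge Z p (sym e))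
  ... | inj₂ refl = edg Z (cyc p) , (cyc p , refl) , Circ.incident-edge Z (cyc p) , (λ e → cyc≢id (circle-1≤k lf Z) p (einj Z _ _ e))

  module _ {B : Subgraph S} (blockB : IsBlockGraph S B) where
    private
      isSubB = proj₁ blockB
      connB = proj₁ (proj₂ blockB)
      noCutB = proj₂ (proj₂ blockB)

    -- B − s is connected, so a walk in it from y' to y closes y s y' into a circle.
    edges-at-vertex-on-circles : ∀ {s y y' g g'} → sv B s → Jn g s y → Jn g' s y' → se B g → se B g' → g ≢ g' →
                                 ¬ ¬ ((Σ (CircleΣ S) λ C → InCE S C g) × (Σ (CircleΣ S) λ C → InCE S C g'))
    edges-at-vertex-on-circles {s} {y} {y'} {g} {g'} sB jg jg' gB g'B g≢g' none = noCutB s (sB , λ conn-s → none (circles conn-s))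
      where
      circles : Connected S (delV S B s) → (Σ (CircleΣ S) λ C → InCE S C g) × (Σ (CircleΣ S) λ C → InCE S C g')
      circles conn-s with reach→walk (conn-s y' y (isSub-end {B} isSubB g'B jg' , λ e → joins-≢ lf jg' (sym e))
                                                  (isSub-end {B} isSubB gB jg , λ e → joins-≢ lf jg (sym e)))
      ... | W , W-s = circleThrough jg (reverseW W ++W single (joins-sym jg'))
                        (all-++ (reverseW W) _ (all-rev W (avoid-s (joins-incidentˡ jg))) ((λ e → g≢g' (sym e)) ∷ [])) ,
                      circleThrough jg' (W ++W single (joins-sym jg)) (all-++ W _ (avoid-s (joins-incidentˡ jg')) (g≢g' ∷ []))
        where
        avoid-s : ∀ {h} → Incident S s h → AllE (_≢ h) W
        avoid-s ih = all-mono (λ e x eq → proj₂ x (subst (Incident S s) (sym eq) ih)) W W-s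

    circle⊆block : (Z : CircleΣ S) → (∀ i → se B (edg Z i)) → ∀ i → sv B (vtx Z i)
    circle⊆block Z ZB i = isSub-end {B} isSubB (ZB i) (joins-sym (joins Z i))

    -- A B-walk from s to Z leaves s by some edge g to y; as y is no cutpoint, another B-walk from s
    -- to Z avoids y, and leaves s by a second edge.
    two-edges-off-circle : (Z : CircleΣ S) → (∀ i → se B (edg Z i)) → ∀ {s} → sv B s → ¬ InCV S Z s →
      ¬ ¬ (Σ Ed λ g → Σ Ed λ g' → Σ Vx λ y → Σ Vx λ y' → Jn g s y × Jn g' s y' × se B g × se B g' × g ≢ g')
    two-edges-off-circle Z ZB {s} sB s∉Z none with reach→walk (connB s (vtx Z zero) sB (circle⊆block Z ZB zero))
    ... | wnil , _ = s∉Z (zero , refl)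
    ... | wcons g jg _ , gB ∷ _ = noCutB _ (isSub-end {B} isSubB gB jg , avoiding-y)
      where
      target : Σ (Fin (suc (k Z))) λ i → vtx Z i ≢ _
      target with vtx Z zero ≟F _
      ... | yes eq = cyc zero , (λ e → cyc≢id (circle-1≤k lf Z) zero (vinj Z _ _ (trans e (sym eq))))
      ... | no ne = zero , ne
      avoiding-y : ¬ Connected S (delV S B _)
      avoiding-y conn-y = leave (proj₁ target , refl)
        (reach→walk (conn-y s _ (sB , joins-≢ lf jg) (circle⊆block Z ZB (proj₁ target) , proj₂ target)))
        where
        leave : ∀ {z} → InCV S Z z → Σ (Walk s z) (AllE (se (delV S B _))) → ⊥
        leave z∈Z (wnil , _) = s∉Z z∈Z
        leave _ (wcons g' jg' _ , (g'B , g'∌y) ∷ _) =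
          none (g , g' , _ , _ , jg , jg' , gB , g'B , λ e → g'∌y (subst (Incident S _) e (joins-incidentʳ jg)))

  isthmus-end∉nontrivialBlock : ∀ {s e0} → Incident S s e0 → Isthmus S e0 → deg S s ≤ 2 → ∀ B → NontrivialBlock S B → ¬ sv B s
  isthmus-end∉nontrivialBlock {s} {e0} i0 iso0 dg B ((blockB , _) , Z , ZB) sB with Circ.InCV? Z s
  ... | yes (p , refl) = deg≤2-¬three dg i0 (Circ.incident-edge Z p) (Circ.incident-prevEdge Z p)
          (λ e → iso0 Z (p , sym e)) (Circ.edge≢prevEdge Z p) (λ e → iso0 Z (Circ.prev Z p , sym e))
  ... | no s∉Z = two-edges-off-circle blockB Z ZB sB s∉Z λ { (g , g' , _ , _ , jg , jg' , gB , g'B , g≢g') →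
        edges-at-vertex-on-circles blockB sB jg jg' gB g'B g≢g' λ { ((C , Cg) , (C' , Cg')) →
        deg≤2-¬three dg i0 (joins-incidentˡ jg) (joins-incidentˡ jg')
          (λ e → iso0 C (subst (InCE S C) (sym e) Cg)) g≢g' (λ e → iso0 C' (subst (InCE S C') (sym e) Cg')) } }

module PathComponents (S : SGraph) (lf : Loopless S) (lc : LineConsistent S) where
  open Walks S
  open SimpleWalks S lf
  open LineGraph S lf
  open CircleStructure S lf
  open TameVertices S lf
  open Blocks S lf
  open ForwardLocal S lf lc
  open CircleComponents S lf lc

  prefixWalk : ∀ {K'} (A : Fin (suc K') → Vx) (Eg : Fin K' → Ed) →
         (∀ q → Jn (Eg q) (A (inject₁ q)) (A (suc q))) → ∀ i →
         Σ (Walk (A zero) (A i)) (AllE (λ e → Σ (Fin K') λ q → Eg q ≡ e))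
  prefixWalk A Eg jn zero = wnil , []
  prefixWalk {suc K'} A Eg jn (suc i) with prefixWalk (λ j → A (suc j)) (λ j → Eg (suc j)) (λ q → jn (suc q)) i
  ... | p , a = wcons (Eg zero) (jn zero) p , (zero , refl) ∷ all-mono (λ e x → suc (proj₁ x) , proj₂ x) p a

  module PathComponent (P : Path S) (npc : NegPathComp S P) where
    K = pk P
    lastV : Fin (suc (suc K))
    lastV = fromℕ (suc K)
    pv = pvtx P
    pe = pedg P
    negative⇒onPath : ∀ i e → Incident S (pv i) e → sg e ≡ ⊖ → InPE S P e
    negative⇒onPath i e ie ne = proj₂ npc (pv i) e (i , refl) ne ie
    path-negative : ∀ q → sg (pe q) ≡ ⊖
    path-negative = proj₁ npc
    path-edge-position : ∀ {i} q → Incident S (pv i) (pe q) → inject₁ q ≡ i ⊎ suc q ≡ i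
    path-edge-position q inc with joins-incident (pjoins P q) inc
    ... | inj₁ x = inj₁ (sym (pvinj P _ _ x))
    ... | inj₂ y = inj₂ (sym (pvinj P _ _ y))
    negative-at-start : ∀ e → Incident S (pv zero) e → sg e ≡ ⊖ → e ≡ pe zero
    negative-at-start e ie ne with negative⇒onPath zero e ie ne
    ... | q , refl with path-edge-position q ie
    ... | inj₁ x = cong pe (inject₁≡zero q x)
    ... | inj₂ ()
    negative-at-end : ∀ e → Incident S (pv lastV) e → sg e ≡ ⊖ → e ≡ pe (fromℕ K)
    negative-at-end e ie ne with negative⇒onPath lastV e ie ne
    ... | q , refl with path-edge-position q ie
    ... | inj₁ x = ⊥-elim (inject₁≢fromℕ q x)
    ... | inj₂ y = cong pe (suc-injective y)
    start-deg≤2 : deg S (startP S P) ≤ 2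
    start-deg≤2 = lone-negative⇒deg≤2 (joins-incidentˡ (pjoins P zero)) (path-negative zero) negative-at-start
    end-deg≤2 : deg S (endP S P) ≤ 2
    end-deg≤2 = lone-negative⇒deg≤2 (joins-incidentʳ (pjoins P (fromℕ K))) (path-negative (fromℕ K)) negative-at-end

    internal-edges : ∀ i → i ≢ zero → i ≢ lastV → Σ (Fin (suc K)) λ q1 → Σ (Fin (suc K)) λ q2 → suc q1 ≡ i × inject₁ q2 ≡ i
    internal-edges i nz nl with view i
    ... | ‵fromℕ = ⊥-elim (nl refl)
    ... | ‵inject₁ zero = ⊥-elim (nz refl)
    ... | ‵inject₁ (suc q2) = inject₁ q2 , suc q2 , refl , refl

    internal-atMostOneOther : ∀ i → i ≢ zero → i ≢ lastV → AtMostOneOther S (pv i) (InPE S P)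
    internal-atMostOneOther i nz nl with internal-edges i nz nl
    ... | q₁ , q₂ , refl , eq₂ = atMostOneOther-beside-negatives (InPE S P) (negative⇒onPath (suc q₁)) (q₁ , refl) (q₂ , refl)
      (joins-incidentʳ (pjoins P q₁)) (subst (λ z → Incident S (pv z) (pe q₂)) eq₂ (joins-incidentˡ (pjoins P q₂)))
      (λ eq → suc≢inject₁ q₁ (sym (trans (cong inject₁ (peinj P _ _ eq)) eq₂))) (path-negative q₁) (path-negative q₂)

    InPV? : ∀ v → Dec (InPV S P v)
    InPV? v = any? (λ i → pv i ≟F v)
    InPE? : ∀ e → Dec (InPE S P e)
    InPE? e = any? (λ q → pe q ≟F e)

    fromStart : ∀ i → Σ (Walk (pv zero) (pv i)) (AllE (InPE S P))
    fromStart = prefixWalk pv pe (pjoins P)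

    pathWalk : ∀ i j → Σ (Walk (pv i) (pv j)) (AllE (InPE S P))
    pathWalk i j = reverseW (proj₁ (fromStart i)) ++W proj₁ (fromStart j) ,
                all-++ (reverseW (proj₁ (fromStart i))) _ (all-rev (proj₁ (fromStart i)) (proj₂ (fromStart i))) (proj₂ (fromStart j))

    avoid : ∀ {e u w} → ¬ InPE S P e → (p : Walk u w) → AllE (InPE S P) p → AllE (_≢ e) p
    avoid ne p a = all-mono (λ f x eq → ne (subst (InPE S P) eq x)) p a

    module ClosingCircle (e : Ed) (jl : Jn e (pv lastV) (pv zero)) (ne : ¬ InPE S P e) where
      circleEdge : Fin (suc (suc K)) → Ed
      circleEdge = snocF pe e
      circle-joins : ∀ j → Jn (circleEdge j) (pv j) (pv (cyc j))
      circle-joins j with view j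
      ... | ‵fromℕ = subst₂ (λ a b → Jn a (pv lastV) (pv b)) (sym (snocF-last pe e)) (sym (cyc-last (suc K))) jl
      ... | ‵inject₁ q = subst₂ (λ a b → Jn a (pv (inject₁ q)) (pv b)) (sym (snocF-inj pe e q)) (sym (cyc-inject₁ q)) (pjoins P q)
      circleEdge-injective : ∀ j j' → circleEdge j ≡ circleEdge j' → j ≡ j'
      circleEdge-injective j j' eq with view j | view j'
      ... | ‵fromℕ | ‵fromℕ = refl
      ... | ‵fromℕ | ‵inject₁ q' = ⊥-elim (ne (q' , sym (trans (sym (snocF-last pe e)) (trans eq (snocF-inj pe e q')))))
      ... | ‵inject₁ q | ‵fromℕ = ⊥-elim (ne (q , trans (sym (snocF-inj pe e q)) (trans eq (snocF-last pe e))))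
      ... | ‵inject₁ q | ‵inject₁ q' = cong inject₁ (peinj P _ _ (trans (sym (snocF-inj pe e q)) (trans eq (snocF-inj pe e q'))))
      circle : CircleΣ S
      circle = record { k = suc K ; vtx = pv ; edg = circleEdge ; vinj = pvinj P ; einj = circleEdge-injective ; joins = circle-joins }
      closingEdge∈ : InCE S circle e
      closingEdge∈ = lastV , snocF-last pe e
      path⊆circle : ∀ f → InPE S P f → InCE S circle f
      path⊆circle f (q , refl) = inject₁ q , snocF-inj pe e q
      circle⊆path : ∀ f → InCE S circle f → InPE S P f ⊎ f ≡ e
      circle⊆path f (j , eq) with view j
      ... | ‵fromℕ = inj₂ (trans (sym eq) (snocF-last pe e))
      ... | ‵inject₁ q = inj₁ (q , trans (sym (snocF-inj pe e q)) eq)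
      others-isthmi : ∀ f j → Incident S (vtx circle j) f → ¬ InCE S circle f → Isthmus S f
      others-isthmi f j ie nx with j ≟F zero | j ≟F lastV
      ... | yes refl | _ = ⊥-elim (deg≤2-¬three start-deg≤2 ie (joins-incidentˡ (pjoins P zero)) (joins-incidentʳ jl)
                               (λ eq → nx (path⊆circle f (zero , sym eq))) (λ eq → ne (zero , eq)) (λ eq → nx (subst (InCE S circle) (sym eq) closingEdge∈)))
      ... | no _ | yes refl = ⊥-elim (deg≤2-¬three end-deg≤2 ie (joins-incidentʳ (pjoins P (fromℕ K))) (joins-incidentˡ jl)
                               (λ eq → nx (path⊆circle f (fromℕ K , sym eq))) (λ eq → ne (fromℕ K , eq)) (λ eq → nx (subst (InCE S circle) (sym eq) closingEdge∈)))
      ... | no nz | no nl = proj₂ (proj₂ (internal-atMostOneOther j nz nl) f ie (λ ip → nx (path⊆circle f ip)))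
      isBlockOf : BlockOf S (circSub S circle)
      isBlockOf = Circ.isBlock circle , circle-maximal circle others-isthmi

    ClosedByBlockCircle : Set₁
    ClosedByBlockCircle = Σ (CircleΣ S) λ C → BlockOf S (circSub S C) × Σ Ed λ e → (σ S e ≡ ⊕) × InCE S C e
                           × (∀ f → InPE S P f → InCE S C f) × (∀ f → InCE S C f → InPE S P f ⊎ f ≡ e)

    induced-or-closing : InducedP S P ⊎ ClosedByBlockCircle
    induced-or-closing with all? (λ e → InPV? (proj₁ (en e)) →-dec (InPV? (proj₂ (en e)) →-dec InPE? e))
    ... | yes ind = inj₁ ind
    ... | no nind with ¬∀⟶∃¬ _ _ (λ e → InPV? (proj₁ (en e)) →-dec (InPV? (proj₂ (en e)) →-dec InPE? e)) nind
    ... | e , ne' = inj₂ (close (ia ≟F zero) (ia ≟F lastV) (ib ≟F zero) (ib ≟F lastV))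
      where
      from∈P : InPV S P (proj₁ (en e))
      from∈P = decidable-stable (InPV? _) (λ na → ne' (λ x → ⊥-elim (na x)))
      to∈P : InPV S P (proj₂ (en e))
      to∈P = decidable-stable (InPV? _) (λ nb → ne' (λ _ x → ⊥-elim (nb x)))
      e∉P : ¬ InPE S P e
      e∉P x = ne' (λ _ _ → x)
      ia = proj₁ from∈P
      ib = proj₁ to∈P
      je : Jn e (pv ia) (pv ib)
      je = inj₁ (cong₂ _,_ (sym (proj₂ from∈P)) (sym (proj₂ to∈P)))
      pos : sg e ≡ ⊕
      pos = ≢⊖⇒≡⊕ (λ neg → e∉P (negative⇒onPath ia e (joins-incidentˡ je) neg))
      closedBy : Jn e (pv lastV) (pv zero) → ClosedByBlockCircle
      closedBy jl = ClosingCircle.circle e jl e∉P , ClosingCircle.isBlockOf e jl e∉P , e , pos , ClosingCircle.closingEdge∈ e jl e∉P , ClosingCircle.path⊆circle e jl e∉P , ClosingCircle.circle⊆path e jl e∉P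
      chord-at-internal : ∀ i j → Jn e (pv i) (pv j) → i ≢ zero → i ≢ lastV → ⊥
      chord-at-internal i j jj nz nl = proj₂ (proj₂ (internal-atMostOneOther i nz nl) e (joins-incidentˡ jj) e∉P) (proj₁ cl) (proj₂ cl)
        where
        cl = circleThrough jj (proj₁ (pathWalk j i)) (avoid e∉P (proj₁ (pathWalk j i)) (proj₂ (pathWalk j i)))
      close : Dec (ia ≡ zero) → Dec (ia ≡ lastV) → Dec (ib ≡ zero) → Dec (ib ≡ lastV) → ClosedByBlockCircle
      close (no nz) (no nl) _ _ = ⊥-elim (chord-at-internal ia ib je nz nl)
      close _ _ (no nz) (no nl) = ⊥-elim (chord-at-internal ib ia (joins-sym je) nz nl)
      close (yes p) _ (yes q) _ = ⊥-elim (joins-≢ lf je (cong pv (trans p (sym q))))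
      close _ (yes p) _ (yes q) = ⊥-elim (joins-≢ lf je (cong pv (trans p (sym q))))
      close (yes p) _ (no _) (yes q) = closedBy (subst₂ (λ x y → Jn e (pv x) (pv y)) q p (joins-sym je))
      close (no _) (yes p) (yes q) _ = closedBy (subst₂ (λ x y → Jn e (pv x) (pv y)) p q je)

    -- A circle through one edge of P runs along all of P: at an internal vertex its second edge
    -- cannot be the isthmus, so it is the neighbouring path edge.
    circle-along-path : (Z : CircleΣ S) → ∀ q → InCE S Z (pe q) → ∀ q' → InCE S Z (pe q')
    circle-along-path Z q Zq = forward-closed⇒all OnZ (backward-closed⇒zero OnZ stepBack q Zq) stepForward
      where
      OnZ : Fin (suc K) → Set
      OnZ q' = InCE S Z (pe q')
      next : ∀ a {q₀} → Incident S (pv (suc (inject₁ a))) (pe q₀) → OnZ q₀ →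
             Σ (Fin (suc K)) λ q' → OnZ q' × pe q' ≢ pe q₀ × (q' ≡ inject₁ a ⊎ q' ≡ suc a)
      next a inc Zq₀ with circle-other-edge Z Zq₀ inc
      ... | h , Zh , inc-h , h≢ with InPE? h
      ... | no ∉P = ⊥-elim (proj₂ (proj₂ (internal-atMostOneOther (suc (inject₁ a)) (λ ())
                       (λ e → inject₁≢fromℕ a (suc-injective e))) h inc-h ∉P) Z Zh)
      ... | yes (q' , refl) with path-edge-position q' inc-h
      ... | inj₁ x = q' , Zh , h≢ , inj₂ (inject₁-injective x)
      ... | inj₂ y = q' , Zh , h≢ , inj₁ (suc-injective y)
      stepForward : ∀ a → OnZ (inject₁ a) → OnZ (suc a)
      stepForward a Za with next a (joins-incidentʳ (pjoins P (inject₁ a))) Za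
      ... | _ , _ , ne , inj₁ refl = ⊥-elim (ne refl)
      ... | _ , Zq' , _ , inj₂ refl = Zq'
      stepBack : ∀ a → OnZ (suc a) → OnZ (inject₁ a)
      stepBack a Za with next a (joins-incidentˡ (pjoins P (suc a))) Za
      ... | _ , Zq' , _ , inj₁ refl = Zq'
      ... | _ , _ , ne , inj₂ refl = ⊥-elim (ne refl)

    inNontrivialBlock : (Z : CircleΣ S) → ∀ q → InCE S Z (pe q) →
                        Σ (Subgraph S) λ B → NontrivialBlock S B × _⊆ₛ_ S (pathSub S P) B
    inNontrivialBlock Z q Zq = B , (isBlockB , Z , (λ i → proj₂ C⊆B (edg Z i) (i , refl))) , (vertices⊆ , edges⊆)
      where
      open Σ (blockContaining (pe q) (circSub S Z) (Circ.InCV? Z) (Circ.InCE? Z) (Circ.isBlock Z) Zq)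
        renaming (proj₁ to B; proj₂ to isBlock-C⊆B)
      isBlockB = proj₁ isBlock-C⊆B
      C⊆B = proj₂ isBlock-C⊆B
      onZ = circle-along-path Z q Zq
      vertexOnZ : ∀ i → InCV S Z (pv i)
      vertexOnZ i with view i
      ... | ‵fromℕ = Circ.endC Z (onZ (fromℕ K)) (pjoins P (fromℕ K))
      ... | ‵inject₁ q' = Circ.endC Z (onZ q') (joins-sym (pjoins P q'))
      vertices⊆ : ∀ v → InPV S P v → sv B v
      vertices⊆ v (i , refl) = proj₁ C⊆B _ (vertexOnZ i)
      edges⊆ : ∀ e → InPE S P e → se B e
      edges⊆ e (q' , refl) = proj₂ C⊆B _ (onZ q')

    inBlock-or-isthmi : (Σ (Subgraph S) λ B → NontrivialBlock S B × _⊆ₛ_ S (pathSub S P) B)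
             ⊎ ((∀ i → Isthmus S (pe i)) × (∀ B → NontrivialBlock S B → ¬ sv B (startP S P) × ¬ sv B (endP S P)))
    inBlock-or-isthmi with any? (λ q → walk? (λ e → ¬? (e ≟F pe q)) (proj₂ (en (pe q))) (proj₁ (en (pe q))))
    ... | yes (q , w , aw) = inj₁ (inNontrivialBlock (proj₁ Z) q (proj₂ Z))
      where Z = circleThrough {f = pe q} (inj₁ refl) w aw
    ... | no nq = inj₂ (isthmi , (λ B nb →
            isthmus-end∉nontrivialBlock (joins-incidentˡ (pjoins P zero)) (isthmi zero) start-deg≤2 B nb ,
            isthmus-end∉nontrivialBlock (joins-incidentʳ (pjoins P (fromℕ K))) (isthmi (fromℕ K)) end-deg≤2 B nb))
      where
      isthmi : ∀ q → Isthmus S (pe q)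
      isthmi q Z iz with around-circle {e = pe q} {x = proj₁ (en (pe q))} (inj₁ refl) Z iz
      ... | p , a = nq (q , castW (joins-functional lf (joins-opposite (inj₁ refl)) (inj₁ refl)) refl p , all-cast _ refl p a)

  cond3 : Cond3 S
  cond3 P npc = induced-or-closing , start-deg≤2 , end-deg≤2 , internal-atMostOneOther , inBlock-or-isthmi
    where open PathComponent P npc

module NegativeComponents (S : SGraph) (lf : Loopless S) (lc : LineConsistent S) where
  open Walks S
  open SimpleWalks S lf
  open LineGraph S lf
  open CircleStructure S lf
  open ForwardLocal S lf lc
  open import Data.List.Membership.DecPropositional (_≟F_ {n S}) using () renaming (_∈?_ to _∈V?_)
  open import Data.List.Membership.DecPropositional (_≟F_ {m S}) using () renaming (_∈?_ to _∈E?_)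

  ClosedAt : ∀ {u w} → Vx → Walk u w → Set
  ClosedAt x p = ∀ e → Incident S x e → Negative S e → e ∈ edges p

  NegativeSimple : ∀ {u w} → Walk u w → Set
  NegativeSimple p = AllE (Negative S) p × Distinct (vertices p)

  negative-circle-component : (C : CircleΣ S) → (∀ i → Negative S (edg C i)) → NegCircleComp S C
  negative-circle-component C negs = negs , closed
    where
    open Circ C
    closed : ∀ v e → InCV S C v → Negative S e → Incident S v e → InCE S C e
    closed v e (p , refl) ne inc with InCE? e
    ... | yes x = x
    ... | no nx = ⊥-elim (¬three-negative inc (incident-edge p) (incident-prevEdge p) (λ eq → nx (p , sym eq))
                            (edge≢prevEdge p) (λ eq → nx (prev p , sym eq)) ne (negs p) (negs (prev p)))

  negative-path-component : ∀ {s t} (W : Walk s t) → NegativeSimple W → ClosedAt s W → ClosedAt t W →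
                            ∀ {e} → e ∈ edges W → Σ (Path S) λ P → NegPathComp S P × (∀ v → v ∈ vertices W → InPV S P v)
  negative-path-component {s} {t} W@(wcons _ _ q) (negs , d) closedˢ closedᵗ _ =
    P , ((λ i → All.lookup negs (edgeAt-∈ W i)) , closed) , (λ v m → vertexAt-surjective W m)
    where
    P : Path S
    P = record { pk = len q ; pvtx = vertexAt W ; pedg = edgeAt W ; pvinj = vertexAt-injective W d
               ; peinj = edgeAt-injective W (distinct-edges lf W d) ; pjoins = edgeAt-joins W }
    closed : ∀ x f → InPV S P x → Negative S f → Incident S x f → InPE S P f
    closed x f (i , refl) nf inc = edgeAt-surjective W (onW (vertexAt W i ≟F s) (vertexAt W i ≟F t))
      where
      onW : Dec (vertexAt W i ≡ s) → Dec (vertexAt W i ≡ t) → f ∈ edges W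
      onW (yes eq) _ = closedˢ f (subst (λ z → Incident S z f) eq inc) nf
      onW (no _) (yes eq) = closedᵗ f (subst (λ z → Incident S z f) eq inc) nf
      onW (no ns) (no nt) with f ∈E? edges W
      ... | yes fW = fW
      ... | no fW with internal-twoEdges W d (vertexAt-∈ W i) ns nt
      ... | e1 , e2 , m1 , m2 , e12 , i1 , i2 =
            ⊥-elim (¬three-negative inc i1 i2 (λ eq → fW (subst (_∈ edges W) (sym eq) m1)) e12
                         (λ eq → fW (subst (_∈ edges W) (sym eq) m2)) nf (All.lookup negs m1) (All.lookup negs m2))

  Extension : ∀ {s t} → Walk s t → Set
  Extension {s} {t} p = (Σ (CircleΣ S) λ C → NegCircleComp S C × (∀ x → x ∈ vertices p → InCV S C x))
        ⊎ (Σ Vx λ s' → Σ (Walk s' t) λ p' → NegativeSimple p' × ClosedAt s' p'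
                       × (∀ x → x ∈ vertices p → x ∈ vertices p') × (∀ e → e ∈ edges p → e ∈ edges p'))

  -- Prepend fresh negative edges at the start for as long as possible (the length bound makes the fuel
  -- suffice).  An edge leading back into the walk can only reach its far end, since an internal
  -- vertex would then carry three negative edges; it then closes up a negative circle.
  extend : ∀ fuel {s t} (p : Walk s t) → NegativeSimple p → n S ≤ len p + fuel → Extension p
  extend fuel {s} {t} p (an , d) bnd with any? (λ e → incident? s e ×-dec ((sg e ≟ˢ ⊖) ×-dec ¬? (e ∈E? edges p)))
  ... | no none = inj₂ (s , p , (an , d) , closedˢ , (λ x m → m) , (λ e m → m))
    where
    closedˢ : ClosedAt s p
    closedˢ e ie ne = decidable-stable (e ∈E? edges p) (λ nm → none (e , ie , ne , nm))
  ... | yes (g , ig , ng , gnot) = next (opposite g s ∈V? vertices p)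
    where
    jg : Jn g s (opposite g s)
    jg = joins-opposite ig
    next : Dec (opposite g s ∈ vertices p) → Extension p
    next (no ny) = go fuel bnd
      where
      p' = wcons g (joins-sym jg) p
      go : ∀ f → n S ≤ len p + f → Extension p
      go zero b = ⊥-elim (NP.<-irrefl refl (NP.≤-trans (NP.n≤1+n _)
                    (NP.≤-trans (simple-length<n p' (dcons ny d)) (NP.≤-trans b (NP.≤-reflexive (NP.+-identityʳ _))))))
      go (suc f) b with extend f p' (ng ∷ an , dcons ny d) (NP.≤-trans b (NP.≤-reflexive (NP.+-suc _ f)))
      ... | inj₁ (C , ncc , inc) = inj₁ (C , ncc , λ x m → inc x (there m))
      ... | inj₂ (s' , p'' , nw , cl , vi , ei) = inj₂ (s' , p'' , nw , cl , (λ x m → vi x (there m)) , (λ e m → ei e (there m)))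
    next (yes my) with opposite g s ≟F t
    ... | yes eq = inj₁ (C , negative-circle-component C negs , λ x m → closeUp-vertex jt p d gnot m)
      where
      jt : Jn g t s
      jt = subst (λ z → Jn g z s) eq (joins-sym jg)
      C = closeUp jt p d gnot
      negs : ∀ i → Negative S (edg C i)
      negs i with closeUp-edge⁻ jt p d gnot (i , refl)
      ... | inj₁ eq' = subst (Negative S) (sym eq') ng
      ... | inj₂ m = All.lookup an m
    ... | no yt with opposite g s ≟F s
    ... | yes ys = ⊥-elim (joins-≢ lf jg (sym ys))
    ... | no ys with internal-twoEdges p d my ys yt
    ... | e1 , e2 , m1 , m2 , e12 , i1 , i2 =
          ⊥-elim (¬three-negative (joins-incidentʳ jg) i1 i2 (λ eq → gnot (subst (_∈ edges p) (sym eq) m1)) e12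
                       (λ eq → gnot (subst (_∈ edges p) (sym eq) m2)) ng (All.lookup an m1) (All.lookup an m2))

  cond1 : Cond1 S
  cond1 v with any? (λ e → incident? v e ×-dec (sg e ≟ˢ ⊖))
  ... | no none = inj₁ (λ e ne inc → none (e , inc , ne))
  ... | yes (e0 , i0 , n0) with extend (n S) p0 nw0 (NP.m≤n+m (n S) 1)
    where
    j0 = joins-opposite i0
    p0 = wcons e0 j0 wnil
    nw0 : NegativeSimple p0
    nw0 = n0 ∷ [] , dcons (λ { (here eq) → joins-≢ lf j0 eq ; (there ()) }) (dcons (λ ()) dnil)
  ... | inj₁ (C , ncc , inC) = inj₂ (inj₁ (C , ncc , inC v (here refl)))
  ... | inj₂ (s1 , p1 , (an1 , d1) , cl1 , vi1 , ei1)
          with extend (n S) (reverseW p1) (all-rev p1 an1 , distinct-reverse p1 d1) (NP.m≤n+m (n S) _)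
  ... | inj₁ (C , ncc , inC) = inj₂ (inj₁ (C , ncc , inC v (∈-vertices-reverse⁺ p1 (vi1 v (here refl)))))
  ... | inj₂ (s2 , p2 , nw2 , cl2 , vi2 , ei2) with negative-path-component p2 nw2 cl2
          (λ e ie ne → ei2 e (∈-edges-reverse⁺ p1 (cl1 e ie ne))) (ei2 e0 (∈-edges-reverse⁺ p1 (ei1 e0 (here refl))))
  ... | P , npc , inP = inj₂ (inj₂ (P , npc , inP v (vi2 v (∈-vertices-reverse⁺ p1 (vi1 v (here refl))))))

theorem5 : (S : SGraph) → Loopless S →
    LineConsistent S ⇔ (Balanced S × Cond1 S × Cond2 S × Cond3 S)
theorem5 S lf = mk⇔
  (λ lc → LineGraph.lineConsistent⇒balanced S lf lc , NegativeComponents.cond1 S lf lc ,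
          CircleComponents.cond2 S lf lc , PathComponents.cond3 S lf lc)
  (λ { (bal , c1 , c2 , c3) → Backward.conditions⇒lineConsistent S lf bal c1 c2 c3 })
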